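{- Let $I$ be a problem with agents $N$, contracts $E$, participants $P(e)$ and Plott choice functions $C_a$ on $E(a)$, and suppose: (1) $N=M\sqcup W$ and agents of $W$ are not connected to each other, i.e. $|P(e)\cap W|\le 1$ for every $e\in E$; (2) for each $w\in W$, $C_w=C_{w(1)}*\cdots*C_{w(q_w)}$ where each $C_{w(j)}$ is a Plott choice function on $E(w)$; (3) $C_m$ is a Plott choice function for every $m\in M$. Then there exist a problem $\widetilde I$ with agents $\widetilde N=\widetilde M\sqcup\widetilde W$, contracts $\widetilde E$ and Plott choice functions $\widetilde C_{\widetilde a}$, together with maps $\pi:\widetilde N\to N$ and $\pi:\widetilde E\to E$, such that: (a) $\pi$ maps $\widetilde M$ bijectively onto $M$, and for each $w\in W$ the fibre $\pi^{ -1}(w)\subseteq\widetilde W$ consists of $q_w$ elements $w(1),\dots,w(q_w)$; (b) for each $w\in W$ and $j$, $\pi$ identifies the contract set $\widetilde E(w(j))$ of $w(j)$ with $E(w)$, and under this identification the choice function of $w(j)$ is $C_{w(j)}$; (c) the map $\widetilde S\mapsto\pi(\widetilde S)$ is a bijection from the set $\mathbf{St}(\widetilde I)$ of stable sets of $\widetilde I$ onto the set $\mathbf{St}(I)$ of stable sets of $I$.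
   Context: All sets are finite. A choice function (CF) on a set $X$ is a map $C:2^X\to 2^X$ with $C(A)\subseteq A$. It is a Plott CF if it is consistent ($C(A)\subseteq B\subseteq A\Rightarrow C(B)=C(A)$) and substitutable ($B\subseteq A\Rightarrow C(A)\cap B\subseteq C(B)$). For CFs $F,G$ on the same set, $(F*G)(A)=F(A)\cup G(A\setminus F(A))$; this operation is associative. A problem consists of a finite set $N$ of agents, a finite set $E$ of contracts, for each $e\in E$ a set $P(e)\subseteq N$ of participants, and for each $a\in N$ a Plott CF $C_a$ on $E(a)=\{e\in E: a\in P(e)\}$. For $S\subseteq E$ write $S(a)=S\cap E(a)$. $S$ is stable if (1) $C_a(S(a))=S(a)$ for all $a\in N$, and (2) every $e\in E$ such that $e\in C_a(S(a)\cup\{e\})$ for all $a\in P(e)$ belongs to $S$. -}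

module Defs where

open import Data.Nat using (ℕ; zero; suc; _≤_)
open import Data.Bool using (Bool; true; false)
open import Data.Fin using (Fin; zero; suc)
open import Data.Fin.Subset using (Subset; ⁅_⁆; _∈_; _∉_; _⊆_; _∩_; _∪_; _─_; ∣_∣)
  renaming (⊥ to ∅)
open import Data.Vec using ([]; _∷_; tabulate)
open import Data.Product using (Σ; _×_; _,_)
open import Relation.Binary.PropositionalEquality using (_≡_)

-- A choice function on X is a map 2^X → 2^X; we
-- represent it by a map on all subsets of Fin k, of which only the
-- values on subsets of X are ever used / constrained.

CF : ℕ → Set
CF k = Subset k → Subset k

IsCF : ∀ {k} → Subset k → CF k → Set
IsCF X C = ∀ A → A ⊆ X → C A ⊆ A

Consistent : ∀ {k} → Subset k → CF k → Set
Consistent X C = ∀ A B → A ⊆ X → C A ⊆ B → B ⊆ A → C B ≡ C A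

Substitutable : ∀ {k} → Subset k → CF k → Set
Substitutable X C = ∀ A B → A ⊆ X → B ⊆ A → (C A ∩ B) ⊆ C B

Plott : ∀ {k} → Subset k → CF k → Set
Plott X C = IsCF X C × Consistent X C × Substitutable X C

_⋆_ : ∀ {k} → CF k → CF k → CF k
(F ⋆ G) A = F A ∪ G (A ─ F A)

-- F₀ * F₁ * ... * F_{q-1}   (the empty product is the zero CF A ↦ ∅,
-- which is the unit of *).
bigStar : ∀ {k} (q : ℕ) → (Fin q → CF k) → CF k
bigStar zero    F = λ _ → ∅
bigStar (suc q) F = F zero ⋆ bigStar q (λ j → F (suc j))

Eof : ∀ {nA nE} → (Fin nE → Subset nA) → Fin nA → Subset nE
Eof P a = tabulate (λ e → Data.Vec.lookup (P e) a)
  where import Data.Vec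

record Problem : Set where
  field
    nA    : ℕ
    nE    : ℕ
    P     : Fin nE → Subset nA
    C     : Fin nA → CF nE
    plott : ∀ a → Plott (Eof P a) (C a)

  E[_] : Fin nA → Subset nE
  E[ a ] = Eof P a

  Stable : Subset nE → Set
  Stable S =
    (∀ a → C a (S ∩ E[ a ]) ≡ S ∩ E[ a ]) ×
    (∀ e → (∀ a → a ∈ P e → e ∈ C a ((S ∩ E[ a ]) ∪ ⁅ e ⁆)) → e ∈ S)

open Problem public

image : ∀ {m k} → (Fin m → Fin k) → Subset m → Subset k
image f []           = ∅
image f (true  ∷ A)  = ⁅ f zero ⁆ ∪ image (λ i → f (suc i)) A
image f (false ∷ A)  = image (λ i → f (suc i)) A

-- Data of the original problem: I, the set W ⊆ N (M = complement of W),
-- the numbers q_w and the component choice functions Cw w j = C_{w(j)}.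

record Reduction (I : Problem) (W : Subset (nA I))
                 (q : Fin (nA I) → ℕ)
                 (Cw : (w : Fin (nA I)) → Fin (q w) → CF (nE I)) : Set where
  field
    I~  : Problem
    W~  : Subset (nA I~)                      -- M~ = complement of W~
    πA  : Fin (nA I~) → Fin (nA I)
    πE  : Fin (nE I~) → Fin (nE I)
    πM       : ∀ a → a ∉ W~ → πA a ∉ W
    πM-inj   : ∀ a b → a ∉ W~ → b ∉ W~ → πA a ≡ πA b → a ≡ b
    πM-surj  : ∀ m → m ∉ W → Σ (Fin (nA I~)) λ a → a ∉ W~ × πA a ≡ m
    πW       : ∀ a → a ∈ W~ → πA a ∈ W
    copy       : (w : Fin (nA I)) → w ∈ W → Fin (q w) → Fin (nA I~)
    copy-W     : ∀ w (w∈ : w ∈ W) j → copy w w∈ j ∈ W~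
    copy-π     : ∀ w (w∈ : w ∈ W) j → πA (copy w w∈ j) ≡ w
    copy-inj   : ∀ w (w∈ : w ∈ W) i j → copy w w∈ i ≡ copy w w∈ j → i ≡ j
    copy-surj  : ∀ w (w∈ : w ∈ W) a → πA a ≡ w → Σ (Fin (q w)) λ j → copy w w∈ j ≡ a
    πE-into  : ∀ w (w∈ : w ∈ W) j e → e ∈ E[_] I~ (copy w w∈ j) → πE e ∈ E[_] I w
    πE-inj   : ∀ w (w∈ : w ∈ W) j e f → e ∈ E[_] I~ (copy w w∈ j) → f ∈ E[_] I~ (copy w w∈ j)
               → πE e ≡ πE f → e ≡ f
    πE-surj  : ∀ w (w∈ : w ∈ W) j e → e ∈ E[_] I w
               → Σ (Fin (nE I~)) λ f → f ∈ E[_] I~ (copy w w∈ j) × πE f ≡ e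
    πE-C     : ∀ w (w∈ : w ∈ W) j A → A ⊆ E[_] I~ (copy w w∈ j)
               → image πE (C I~ (copy w w∈ j) A) ≡ Cw w j (image πE A)
    St-into  : ∀ S → Stable I~ S → Stable I (image πE S)
    St-inj   : ∀ S T → Stable I~ S → Stable I~ T → image πE S ≡ image πE T → S ≡ T
    St-surj  : ∀ S → Stable I S → Σ (Subset (nE I~)) λ S~ → Stable I~ S~ × image πE S~ ≡ S

module Submission where

open import Defs
open import Data.Nat using (ℕ; zero; suc; _≤_; _<_; _+_; z≤n; s≤s)
import Data.Nat.Properties as ℕ
open import Data.Bool using (Bool; true; false)
open import Data.Fin using (Fin; zero; suc; toℕ; fromℕ<; _↑ˡ_; _↑ʳ_; splitAt; join)
import Data.Fin.Properties as Fin
open import Data.Fin.Subset using (Subset; _∈_; _∉_; _⊆_; _∩_; _∪_; _─_; _-_; ⁅_⁆; ∣_∣)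
  renaming (⊥ to ∅)
open import Data.Fin.Subset.Properties
  using (_∈?_; ∉⊥; x∈⁅x⁆; x∈⁅y⁆⇒x≡y; ⊆-antisym; p⊆p∪q; q⊆p∪q; x∈p∪q⁻; x∈p∩q⁺; x∈p∩q⁻;
         p∩q⊆p; p∩q⊆q; p─q⊆p; x∈p∧x∉q⇒x∈p─q; x∈p∧x≢y⇒x∈p-y; x∈p⇒∣p-x∣<∣p∣; ∣⁅x⁆∣≡1; p⊆q⇒∣p∣≤∣q∣)
open import Data.Vec using (_∷_; []; tabulate; lookup; here; there)
open import Data.Vec.Properties using (lookup∘tabulate; []=⇒lookup; lookup⇒[]=)
open import Data.Vec.Functional using (foldr; tail)
open import Data.Product using (Σ; _×_; _,_; proj₁; proj₂)
open import Data.Sum using (_⊎_; inj₁; inj₂)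
open import Data.Empty using (⊥-elim)
open import Relation.Nullary using (Dec; yes; no; does; ¬_)
open import Relation.Nullary.Decidable using (dec-true; _→-dec_; _×-dec_; _⊎-dec_; ¬?; decidable-stable)
open import Relation.Binary.Definitions using (tri<; tri≈; tri>)
open import Relation.Binary.PropositionalEquality

-- Each w ∈ W is split into clones w(1), …, w(q_w) with choice functions
-- C_{w(j)}, and each contract of w into copies, copy j being signed by w(j).
-- A set A fixed by C_{w(1)} * ⋯ * C_{w(q)} splits uniquely into parts X_j,
-- each fixed by C_{w(j)} and rejected by the earlier factors, and a contract e
-- is accepted by the product against A iff some C_{w(j)} accepts it against
-- X_j.  Hence a stable set of I, with every contract of w replaced by its copy
-- numbered after its part, is a stable set of the split problem, and every
-- stable set of the split problem arises so, provided it contains at most one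
-- copy of each contract.  Since W is unconnected this last point is enforced
-- by letting the agents of M take part in all copies and keep only the first
-- one; when M is empty both problems have a unique stable set.

∈-tabulate⁺ : ∀ {n} (f : Fin n → Bool) {x} → f x ≡ true → x ∈ tabulate f
∈-tabulate⁺ f {x} fx = lookup⇒[]= x (tabulate f) (trans (lookup∘tabulate f x) fx)

∈-tabulate⁻ : ∀ {n} (f : Fin n → Bool) {x} → x ∈ tabulate f → f x ≡ true
∈-tabulate⁻ f {x} x∈ = trans (sym (lookup∘tabulate f x)) ([]=⇒lookup x∈)

opaque
  select : ∀ {n} {Q : Fin n → Set} → (∀ x → Dec (Q x)) → Subset n
  select Q? = tabulate (λ x → does (Q? x))

  ∈-select⁺ : ∀ {n} {Q : Fin n → Set} (Q? : ∀ x → Dec (Q x)) {x} → Q x → x ∈ select Q?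
  ∈-select⁺ Q? {x} q = ∈-tabulate⁺ (λ x → does (Q? x)) (dec-true (Q? x) q)

  ∈-select⁻ : ∀ {n} {Q : Fin n → Set} (Q? : ∀ x → Dec (Q x)) {x} → x ∈ select Q? → Q x
  ∈-select⁻ Q? {x} x∈ with Q? x | ∈-tabulate⁻ (λ x → does (Q? x)) x∈
  ... | yes q | _ = q

∈-Eof⁺ : ∀ {nA nE} (P : Fin nE → Subset nA) {a e} → a ∈ P e → e ∈ Eof P a
∈-Eof⁺ P {a} a∈ = ∈-tabulate⁺ (λ e → lookup (P e) a) ([]=⇒lookup a∈)

∈-Eof⁻ : ∀ {nA nE} (P : Fin nE → Subset nA) {a e} → e ∈ Eof P a → a ∈ P e
∈-Eof⁻ P {a} {e} e∈ = lookup⇒[]= a (P e) (∈-tabulate⁻ (λ e → lookup (P e) a) e∈)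

x∈p─q⇒x∉q : ∀ {n} (p q : Subset n) {x} → x ∈ p ─ q → x ∉ q
x∈p─q⇒x∉q (true  ∷ p) (false ∷ q) here      ()
x∈p─q⇒x∉q (_     ∷ p) (_     ∷ q) (there m) (there k) = x∈p─q⇒x∉q p q m k

∪⁅⁆-⊆ : ∀ {n} {Z Y : Subset n} {f} → Z ⊆ Y → f ∈ Y → Z ∪ ⁅ f ⁆ ⊆ Y
∪⁅⁆-⊆ {Z = Z} Z⊆Y f∈Y m with x∈p∪q⁻ Z _ m
... | inj₁ x∈Z = Z⊆Y x∈Z
... | inj₂ x∈f rewrite x∈⁅y⁆⇒x≡y _ x∈f = f∈Y

∪⁅⁆-∩ : ∀ {n} (B Y : Subset n) {e} → e ∈ Y → (B ∪ ⁅ e ⁆) ∩ Y ≡ (B ∩ Y) ∪ ⁅ e ⁆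
∪⁅⁆-∩ B Y e∈Y = ⊆-antisym to from
  where
    to : (B ∪ ⁅ _ ⁆) ∩ Y ⊆ (B ∩ Y) ∪ ⁅ _ ⁆
    to m with x∈p∩q⁻ _ Y m
    ... | x∈B∪e , x∈Y with x∈p∪q⁻ B _ x∈B∪e
    ... | inj₁ x∈B = p⊆p∪q _ (x∈p∩q⁺ (x∈B , x∈Y))
    ... | inj₂ x∈e = q⊆p∪q _ _ x∈e
    from : (B ∩ Y) ∪ ⁅ _ ⁆ ⊆ (B ∪ ⁅ _ ⁆) ∩ Y
    from m with x∈p∪q⁻ (B ∩ Y) _ m
    ... | inj₁ x∈B∩Y = x∈p∩q⁺ (p⊆p∪q _ (p∩q⊆p B Y x∈B∩Y) , p∩q⊆q B Y x∈B∩Y)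
    ... | inj₂ x∈e rewrite x∈⁅y⁆⇒x≡y _ x∈e = x∈p∩q⁺ (q⊆p∪q B _ (x∈⁅x⁆ _) , e∈Y)

∪⁅⁆-─ : ∀ {n} (A Z : Subset n) {e} → e ∉ Z → (A ∪ ⁅ e ⁆) ─ Z ≡ (A ─ Z) ∪ ⁅ e ⁆
∪⁅⁆-─ A Z e∉Z = ⊆-antisym to from
  where
    to : (A ∪ ⁅ _ ⁆) ─ Z ⊆ (A ─ Z) ∪ ⁅ _ ⁆
    to m with x∈p∪q⁻ A _ (p─q⊆p _ Z m)
    ... | inj₁ x∈A = p⊆p∪q _ (x∈p∧x∉q⇒x∈p─q x∈A (x∈p─q⇒x∉q _ Z m))
    ... | inj₂ x∈e = q⊆p∪q _ _ x∈e
    from : (A ─ Z) ∪ ⁅ _ ⁆ ⊆ (A ∪ ⁅ _ ⁆) ─ Z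
    from m with x∈p∪q⁻ (A ─ Z) _ m
    ... | inj₁ x∈A─Z = x∈p∧x∉q⇒x∈p─q (p⊆p∪q _ (p─q⊆p A Z x∈A─Z)) (x∈p─q⇒x∉q A Z x∈A─Z)
    ... | inj₂ x∈e rewrite x∈⁅y⁆⇒x≡y _ x∈e = x∈p∧x∉q⇒x∈p─q (q⊆p∪q A _ (x∈⁅x⁆ _)) e∉Z

∪⁅⁆-absorb : ∀ {n} (B : Subset n) {e} → e ∈ B → B ∪ ⁅ e ⁆ ≡ B
∪⁅⁆-absorb B e∈B = ⊆-antisym (∪⁅⁆-⊆ (λ x∈B → x∈B) e∈B) (p⊆p∪q _)

∣p∣≤1⇒x≡y : ∀ {n} (p : Subset n) {x y} → ∣ p ∣ ≤ 1 → x ∈ p → y ∈ p → x ≡ y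
∣p∣≤1⇒x≡y p {x} {y} ∣p∣≤1 x∈p y∈p with x Fin.≟ y
... | yes x≡y = x≡y
... | no x≢y = ⊥-elim (ℕ.<-irrefl refl (ℕ.≤-trans 2≤∣p∣ ∣p∣≤1))
  where
    1≤∣p-x∣ : 1 ≤ ∣ p - x ∣
    1≤∣p-x∣ = ℕ.≤-trans (ℕ.≤-reflexive (sym (∣⁅x⁆∣≡1 y)))
      (p⊆q⇒∣p∣≤∣q∣ λ z∈y → subst (_∈ p - x) (sym (x∈⁅y⁆⇒x≡y y z∈y))
                                  (x∈p∧x≢y⇒x∈p-y y∈p (λ y≡x → x≢y (sym y≡x))))
    2≤∣p∣ : 2 ≤ ∣ p ∣
    2≤∣p∣ = ℕ.≤-trans (s≤s 1≤∣p-x∣) (x∈p⇒∣p-x∣<∣p∣ x∈p)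

∈-image⁺ : ∀ {m k} (f : Fin m → Fin k) (A : Subset m) {y x} → y ∈ A → f y ≡ x → x ∈ image f A
∈-image⁺ f (true  ∷ A) here      refl = p⊆p∪q _ (x∈⁅x⁆ _)
∈-image⁺ f (true  ∷ A) (there p) fy≡x = q⊆p∪q _ _ (∈-image⁺ (λ i → f (suc i)) A p fy≡x)
∈-image⁺ f (false ∷ A) (there p) fy≡x = ∈-image⁺ (λ i → f (suc i)) A p fy≡x

∈-image⁻ : ∀ {m k} (f : Fin m → Fin k) (A : Subset m) {x} → x ∈ image f A
         → Σ (Fin m) λ y → y ∈ A × f y ≡ x
∈-image⁻ f [] x∈ = ⊥-elim (∉⊥ x∈)
∈-image⁻ f (true ∷ A) x∈ with x∈p∪q⁻ _ _ x∈
... | inj₁ x∈f0 = zero , here , sym (x∈⁅y⁆⇒x≡y _ x∈f0)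
... | inj₂ x∈fA with ∈-image⁻ (λ i → f (suc i)) A x∈fA
...   | y , y∈A , fy≡x = suc y , there y∈A , fy≡x
∈-image⁻ f (false ∷ A) x∈ with ∈-image⁻ (λ i → f (suc i)) A x∈
... | y , y∈A , fy≡x = suc y , there y∈A , fy≡x

image-mono : ∀ {m k} (f : Fin m → Fin k) {A B : Subset m} → A ⊆ B → image f A ⊆ image f B
image-mono f {A} {B} A⊆B x∈ with ∈-image⁻ f A x∈
... | y , y∈A , fy≡x = ∈-image⁺ f B (A⊆B y∈A) fy≡x

image-∪⁅⁆ : ∀ {m k} (f : Fin m → Fin k) (A : Subset m) x → image f (A ∪ ⁅ x ⁆) ≡ image f A ∪ ⁅ f x ⁆
image-∪⁅⁆ f A x = ⊆-antisym to from
  where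
    to : image f (A ∪ ⁅ x ⁆) ⊆ image f A ∪ ⁅ f x ⁆
    to m with ∈-image⁻ f (A ∪ ⁅ x ⁆) m
    ... | y , y∈ , refl with x∈p∪q⁻ A _ y∈
    ...   | inj₁ y∈A = p⊆p∪q _ (∈-image⁺ f A y∈A refl)
    ...   | inj₂ y∈x rewrite x∈⁅y⁆⇒x≡y _ y∈x = q⊆p∪q _ _ (x∈⁅x⁆ _)
    from : image f A ∪ ⁅ f x ⁆ ⊆ image f (A ∪ ⁅ x ⁆)
    from m with x∈p∪q⁻ (image f A) _ m
    ... | inj₁ y∈fA = image-mono f {A} {A ∪ ⁅ x ⁆} (p⊆p∪q _) y∈fA
    ... | inj₂ y∈fx = ∈-image⁺ f (A ∪ ⁅ x ⁆) (q⊆p∪q A _ (x∈⁅x⁆ x)) (sym (x∈⁅y⁆⇒x≡y _ y∈fx))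

-- Plott choice functions

module PlottCF {n} {X : Subset n} {C : CF n} (plott : Plott X C) where

  private
    C⊆ : IsCF X C
    C⊆ = proj₁ plott
    consistent : Consistent X C
    consistent = proj₁ (proj₂ plott)
    substitutable : Substitutable X C
    substitutable = proj₂ (proj₂ plott)

  C≡-between : ∀ R B Z → R ⊆ X → C R ≡ Z → Z ⊆ B → B ⊆ R → C B ≡ Z
  C≡-between R B Z R⊆X CR≡Z Z⊆B B⊆R =
    trans (consistent R B R⊆X (λ x∈CR → Z⊆B (subst (_ ∈_) CR≡Z x∈CR)) B⊆R) CR≡Z

  C-idem : ∀ A → A ⊆ X → C (C A) ≡ C A
  C-idem A A⊆X = C≡-between A (C A) (C A) A⊆X refl (λ x∈ → x∈) (C⊆ A A⊆X)

  fixed∧rejecting⇒C≡ : ∀ Y Z → Y ⊆ X → Z ⊆ Y → C Z ≡ Z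
                     → (∀ f → f ∈ Y → f ∉ Z → f ∉ C (Z ∪ ⁅ f ⁆)) → C Y ≡ Z
  fixed∧rejecting⇒C≡ Y Z Y⊆X Z⊆Y CZ≡Z rejects =
    trans (sym (consistent Y Z Y⊆X CY⊆Z Z⊆Y)) CZ≡Z
    where
      CY⊆Z : C Y ⊆ Z
      CY⊆Z {f} f∈CY with f ∈? Z
      ... | yes f∈Z = f∈Z
      ... | no f∉Z = ⊥-elim (rejects f f∈Y f∉Z
              (substitutable Y (Z ∪ ⁅ f ⁆) Y⊆X (∪⁅⁆-⊆ Z⊆Y f∈Y) (x∈p∩q⁺ (f∈CY , q⊆p∪q Z _ (x∈⁅x⁆ f)))))
        where f∈Y = C⊆ Y Y⊆X f∈CY

  path-independence-⁅⁆ : ∀ A Z e → A ⊆ X → e ∈ X → C A ≡ Z → C (A ∪ ⁅ e ⁆) ≡ C (Z ∪ ⁅ e ⁆)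
  path-independence-⁅⁆ A Z e A⊆X e∈X CA≡Z =
    sym (consistent (A ∪ ⁅ e ⁆) (Z ∪ ⁅ e ⁆) A∪e⊆X C[A∪e]⊆Z∪e Z∪e⊆A∪e)
    where
      A∪e⊆X : A ∪ ⁅ e ⁆ ⊆ X
      A∪e⊆X = ∪⁅⁆-⊆ A⊆X e∈X
      C[A∪e]⊆Z∪e : C (A ∪ ⁅ e ⁆) ⊆ Z ∪ ⁅ e ⁆
      C[A∪e]⊆Z∪e {f} f∈ with x∈p∪q⁻ A ⁅ e ⁆ (C⊆ _ A∪e⊆X f∈)
      ... | inj₂ f∈e = q⊆p∪q Z _ f∈e
      ... | inj₁ f∈A = p⊆p∪q _ (subst (f ∈_) CA≡Z
                         (substitutable (A ∪ ⁅ e ⁆) A A∪e⊆X (p⊆p∪q _) (x∈p∩q⁺ (f∈ , f∈A))))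
      Z∪e⊆A∪e : Z ∪ ⁅ e ⁆ ⊆ A ∪ ⁅ e ⁆
      Z∪e⊆A∪e {f} f∈ with x∈p∪q⁻ Z ⁅ e ⁆ f∈
      ... | inj₂ f∈e = q⊆p∪q A _ f∈e
      ... | inj₁ f∈Z = p⊆p∪q _ (C⊆ A A⊆X (subst (f ∈_) (sym CA≡Z) f∈Z))

  rejected⇒C[Z∪e]≡Z : ∀ Z e → Z ⊆ X → e ∈ X → C Z ≡ Z → e ∉ C (Z ∪ ⁅ e ⁆) → C (Z ∪ ⁅ e ⁆) ≡ Z
  rejected⇒C[Z∪e]≡Z Z e Z⊆X e∈X CZ≡Z e∉ =
    trans (sym (consistent (Z ∪ ⁅ e ⁆) Z (∪⁅⁆-⊆ Z⊆X e∈X) C[Z∪e]⊆Z (p⊆p∪q _))) CZ≡Z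
    where
      C[Z∪e]⊆Z : C (Z ∪ ⁅ e ⁆) ⊆ Z
      C[Z∪e]⊆Z f∈ with x∈p∪q⁻ Z _ (C⊆ _ (∪⁅⁆-⊆ Z⊆X e∈X) f∈)
      ... | inj₁ f∈Z = f∈Z
      ... | inj₂ f∈e rewrite x∈⁅y⁆⇒x≡y _ f∈e = ⊥-elim (e∉ f∈)

-- Products of choice functions

-- The fixed points of F 0 * ⋯ * F (q-1) are exactly the sets that split in
-- this way (with Xs j = F j (A ∖ earlier parts)).
record StarSplitting {n q} (X : Subset n) (F : Fin q → CF n) (Xs : Fin q → Subset n)
                     (A : Subset n) : Set where
  field
    ⊆X            : A ⊆ X
    covers        : ∀ e → e ∈ A → Σ (Fin q) λ j → e ∈ Xs j
    part⊆         : ∀ j → Xs j ⊆ A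
    part-fixed    : ∀ j → F j (Xs j) ≡ Xs j
    disjoint      : ∀ i j e → e ∈ Xs i → e ∈ Xs j → i ≡ j
    rejects-later : ∀ j j′ e → e ∈ Xs j′ → toℕ j < toℕ j′ → e ∉ F j (Xs j ∪ ⁅ e ⁆)
open StarSplitting public

module _ {n} (X : Subset n) where

  bigStar-⊆ : ∀ q (F : Fin q → CF n) → (∀ j → Plott X (F j)) → ∀ B → B ⊆ X → bigStar q F B ⊆ B
  bigStar-⊆ zero    F plott B B⊆X x∈ = ⊥-elim (∉⊥ x∈)
  bigStar-⊆ (suc q) F plott B B⊆X x∈ with x∈p∪q⁻ _ _ x∈
  ... | inj₁ x∈F₀B = proj₁ (plott zero) B B⊆X x∈F₀B
  ... | inj₂ x∈rest = p─q⊆p B _ (bigStar-⊆ q (tail F) (λ j → plott (suc j)) (B ─ F zero B)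
                                     (λ y∈ → B⊆X (p─q⊆p B _ y∈)) x∈rest)

  F⊆bigStar : ∀ q (F : Fin q → CF n) → (∀ j → Plott X (F j)) → ∀ A → A ⊆ X
            → ∀ j → F j A ⊆ bigStar q F A
  F⊆bigStar (suc q) F plott A A⊆X zero    x∈ = p⊆p∪q _ x∈
  F⊆bigStar (suc q) F plott A A⊆X (suc j) {x} x∈ with x ∈? F zero A
  ... | yes x∈F₀A = p⊆p∪q _ x∈F₀A
  ... | no  x∉F₀A = q⊆p∪q _ _ (F⊆bigStar q (tail F) (λ j → plott (suc j)) (A ─ F zero A)
                       (λ y∈ → A⊆X (p─q⊆p A _ y∈)) j
                       (proj₂ (proj₂ (plott (suc j))) A (A ─ F zero A) A⊆X (p─q⊆p A _)
                          (x∈p∩q⁺ (x∈ , x∈p∧x∉q⇒x∈p─q (proj₁ (plott (suc j)) A A⊆X x∈) x∉F₀A))))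

  module _ {q} (F : Fin (suc q) → CF n) (plott : ∀ j → Plott X (F j))
           (Xs : Fin (suc q) → Subset n) (A : Subset n) (split : StarSplitting X F Xs A) where

    head-choice : F zero A ≡ Xs zero
    head-choice = PlottCF.fixed∧rejecting⇒C≡ (plott zero) A (Xs zero) (⊆X split) (part⊆ split zero)
                    (part-fixed split zero) rejects
      where
        rejects : ∀ f → f ∈ A → f ∉ Xs zero → f ∉ F zero (Xs zero ∪ ⁅ f ⁆)
        rejects f f∈A f∉X₀ with covers split f f∈A
        ... | zero  , f∈X₀ = ⊥-elim (f∉X₀ f∈X₀)
        ... | suc j , f∈Xj = rejects-later split zero (suc j) f f∈Xj (s≤s z≤n)

    tail-splitting : StarSplitting X (tail F) (tail Xs) (A ─ Xs zero)
    tail-splitting = record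
      { ⊆X            = λ x∈ → ⊆X split (p─q⊆p A _ x∈)
      ; covers        = covers′
      ; part⊆         = λ j x∈ → x∈p∧x∉q⇒x∈p─q (part⊆ split (suc j) x∈)
                                    (λ x∈X₀ → 0≢suc (disjoint split zero (suc j) _ x∈X₀ x∈))
      ; part-fixed    = λ j → part-fixed split (suc j)
      ; disjoint      = λ i j e e∈i e∈j → Fin.suc-injective (disjoint split (suc i) (suc j) e e∈i e∈j)
      ; rejects-later = λ j j′ e e∈ j<j′ → rejects-later split (suc j) (suc j′) e e∈ (s≤s j<j′)
      }
      where
        0≢suc : ∀ {j : Fin q} → zero ≢ suc j
        0≢suc ()
        covers′ : ∀ e → e ∈ A ─ Xs zero → Σ (Fin q) λ j → e ∈ Xs (suc j)
        covers′ e e∈ with covers split e (p─q⊆p A _ e∈)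
        ... | zero  , e∈X₀ = ⊥-elim (x∈p─q⇒x∉q A _ e∈ e∈X₀)
        ... | suc j , e∈Xj = j , e∈Xj

  splitting⇒bigStar-fixed : ∀ q (F : Fin q → CF n) → (∀ j → Plott X (F j))
                          → ∀ Xs A → StarSplitting X F Xs A → bigStar q F A ≡ A
  splitting⇒bigStar-fixed zero F plott Xs A split =
    ⊆-antisym (λ x∈ → ⊥-elim (∉⊥ x∈)) (λ {x} x∈A → no-part (covers split x x∈A))
    where no-part : ∀ {x} → Σ (Fin 0) _ → x ∈ ∅
          no-part (() , _)
  splitting⇒bigStar-fixed (suc q) F plott Xs A split
    rewrite head-choice F plott Xs A split
          | splitting⇒bigStar-fixed q (tail F) (λ j → plott (suc j)) (tail Xs) (A ─ Xs zero)
              (tail-splitting F plott Xs A split)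
    = ⊆-antisym to from
    where
      to : Xs zero ∪ (A ─ Xs zero) ⊆ A
      to x∈ with x∈p∪q⁻ _ _ x∈
      ... | inj₁ x∈X₀ = part⊆ split zero x∈X₀
      ... | inj₂ x∈A─X₀ = p─q⊆p A _ x∈A─X₀
      from : A ⊆ Xs zero ∪ (A ─ Xs zero)
      from {x} x∈A with x ∈? Xs zero
      ... | yes x∈X₀ = p⊆p∪q _ x∈X₀
      ... | no x∉X₀ = q⊆p∪q _ _ (x∈p∧x∉q⇒x∈p─q x∈A x∉X₀)

  splitting-unique : ∀ q (F : Fin q → CF n) → (∀ j → Plott X (F j)) → ∀ Xs Ys A
                   → StarSplitting X F Xs A → StarSplitting X F Ys A → ∀ j → Xs j ≡ Ys j
  splitting-unique (suc q) F plott Xs Ys A splitX splitY zero =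
    trans (sym (head-choice F plott Xs A splitX)) (head-choice F plott Ys A splitY)
  splitting-unique (suc q) F plott Xs Ys A splitX splitY (suc j) =
    splitting-unique q (tail F) (λ j → plott (suc j)) (tail Xs) (tail Ys) (A ─ Xs zero)
      (tail-splitting F plott Xs A splitX) tail-splitY j
    where
      Y₀≡X₀ : Ys zero ≡ Xs zero
      Y₀≡X₀ = trans (sym (head-choice F plott Ys A splitY)) (head-choice F plott Xs A splitX)
      tail-splitY : StarSplitting X (tail F) (tail Ys) (A ─ Xs zero)
      tail-splitY = subst (λ Z → StarSplitting X (tail F) (tail Ys) (A ─ Z)) Y₀≡X₀
                      (tail-splitting F plott Ys A splitY)

  bigStar-fixed⇒splitting : ∀ q (F : Fin q → CF n) → (∀ j → Plott X (F j)) → ∀ A → A ⊆ X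
                          → bigStar q F A ≡ A → Σ (Fin q → Subset n) λ Xs → StarSplitting X F Xs A
  bigStar-fixed⇒splitting zero F plott A A⊆X fixed = (λ ()) , record
    { ⊆X = A⊆X ; covers = λ e e∈ → ⊥-elim (∉⊥ (subst (e ∈_) (sym fixed) e∈)) ; part⊆ = λ ()
    ; part-fixed = λ () ; disjoint = λ () ; rejects-later = λ () }
  bigStar-fixed⇒splitting (suc q) F plott A A⊆X fixed
    with bigStar-fixed⇒splitting q (tail F) (λ j → plott (suc j)) (A ─ F zero A) (λ x∈ → A⊆X (p─q⊆p A _ x∈)) rest-fixed
    where
      rest-fixed : bigStar q (tail F) (A ─ F zero A) ≡ A ─ F zero A
      rest-fixed = ⊆-antisym (bigStar-⊆ q (tail F) (λ j → plott (suc j)) _ (λ x∈ → A⊆X (p─q⊆p A _ x∈))) in-rest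
        where
          in-rest : A ─ F zero A ⊆ bigStar q (tail F) (A ─ F zero A)
          in-rest {x} x∈ with x∈p∪q⁻ _ _ (subst (x ∈_) (sym fixed) (p─q⊆p A _ x∈))
          ... | inj₁ x∈F₀A = ⊥-elim (x∈p─q⇒x∉q A _ x∈ x∈F₀A)
          ... | inj₂ x∈rest = x∈rest
  ... | Xs′ , split′ = Xs , record
    { ⊆X = A⊆X ; covers = covers′ ; part⊆ = part⊆′ ; part-fixed = part-fixed′
    ; disjoint = disjoint′ ; rejects-later = rejects-later′ }
    where
      Xs : Fin (suc q) → Subset n
      Xs zero    = F zero A
      Xs (suc j) = Xs′ j
      covers′ : ∀ e → e ∈ A → Σ (Fin (suc q)) λ j → e ∈ Xs j
      covers′ e e∈A with e ∈? F zero A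
      ... | yes e∈X₀ = zero , e∈X₀
      ... | no e∉X₀ with covers split′ e (x∈p∧x∉q⇒x∈p─q e∈A e∉X₀)
      ...   | j , e∈Xj = suc j , e∈Xj
      part⊆′ : ∀ j → Xs j ⊆ A
      part⊆′ zero    = proj₁ (plott zero) A A⊆X
      part⊆′ (suc j) x∈ = p─q⊆p A _ (part⊆ split′ j x∈)
      part-fixed′ : ∀ j → F j (Xs j) ≡ Xs j
      part-fixed′ zero    = PlottCF.C-idem (plott zero) A A⊆X
      part-fixed′ (suc j) = part-fixed split′ j
      disjoint′ : ∀ i j e → e ∈ Xs i → e ∈ Xs j → i ≡ j
      disjoint′ zero    zero    e _ _ = refl
      disjoint′ zero    (suc j) e e∈X₀ e∈Xj = ⊥-elim (x∈p─q⇒x∉q A _ (part⊆ split′ j e∈Xj) e∈X₀)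
      disjoint′ (suc i) zero    e e∈Xi e∈X₀ = ⊥-elim (x∈p─q⇒x∉q A _ (part⊆ split′ i e∈Xi) e∈X₀)
      disjoint′ (suc i) (suc j) e e∈Xi e∈Xj = cong suc (disjoint split′ i j e e∈Xi e∈Xj)
      -- e ∈ A lies outside F 0 A, and by consistency F 0 (F 0 A ∪ {e}) = F 0 A.
      rejects-later′ : ∀ j j′ e → e ∈ Xs j′ → toℕ j < toℕ j′ → e ∉ F j (Xs j ∪ ⁅ e ⁆)
      rejects-later′ zero (suc j′) e e∈ _ e∈F₀ =
        x∈p─q⇒x∉q A _ (part⊆ split′ j′ e∈)
          (subst (e ∈_) (PlottCF.C≡-between (plott zero) A (F zero A ∪ ⁅ e ⁆) (F zero A) A⊆X refl
                           (p⊆p∪q _) (∪⁅⁆-⊆ (proj₁ (plott zero) A A⊆X) (p─q⊆p A _ (part⊆ split′ j′ e∈))))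
             e∈F₀)
      rejects-later′ (suc j) (suc j′) e e∈ (s≤s j<j′) = rejects-later split′ j j′ e e∈ j<j′

  module _ {q} (F : Fin (suc q) → CF n) (plott : ∀ j → Plott X (F j))
           (Xs : Fin (suc q) → Subset n) (A : Subset n) (split : StarSplitting X F Xs A)
           (e : Fin n) (e∈X : e ∈ X) (e∉A : e ∉ A) where

    F₀[A∪e]≡F₀[X₀∪e] : F zero (A ∪ ⁅ e ⁆) ≡ F zero (Xs zero ∪ ⁅ e ⁆)
    F₀[A∪e]≡F₀[X₀∪e] = PlottCF.path-independence-⁅⁆ (plott zero) A (Xs zero) e (⊆X split) e∈X
                         (head-choice F plott Xs A split)

    rest-after-rejection : e ∉ F zero (Xs zero ∪ ⁅ e ⁆)
                         → (A ∪ ⁅ e ⁆) ─ F zero (A ∪ ⁅ e ⁆) ≡ (A ─ Xs zero) ∪ ⁅ e ⁆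
    rest-after-rejection e∉ = begin
      (A ∪ ⁅ e ⁆) ─ F zero (A ∪ ⁅ e ⁆)  ≡⟨ cong ((A ∪ ⁅ e ⁆) ─_) F₀[A∪e]≡X₀ ⟩
      (A ∪ ⁅ e ⁆) ─ Xs zero            ≡⟨ ∪⁅⁆-─ A (Xs zero) (λ e∈X₀ → e∉A (part⊆ split zero e∈X₀)) ⟩
      (A ─ Xs zero) ∪ ⁅ e ⁆            ∎
      where
        open ≡-Reasoning
        F₀[A∪e]≡X₀ : F zero (A ∪ ⁅ e ⁆) ≡ Xs zero
        F₀[A∪e]≡X₀ = trans F₀[A∪e]≡F₀[X₀∪e]
          (PlottCF.rejected⇒C[Z∪e]≡Z (plott zero) (Xs zero) e (λ x∈ → ⊆X split (part⊆ split zero x∈))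
             e∈X (part-fixed split zero) e∉)

    e∉A─X₀ : e ∉ A ─ Xs zero
    e∉A─X₀ e∈ = e∉A (p─q⊆p A _ e∈)

  bigStar-accepts⇒part-accepts : ∀ q (F : Fin q → CF n) → (∀ j → Plott X (F j)) → ∀ Xs A
    → StarSplitting X F Xs A → ∀ e → e ∈ X → e ∉ A
    → e ∈ bigStar q F (A ∪ ⁅ e ⁆) → Σ (Fin q) λ j → e ∈ F j (Xs j ∪ ⁅ e ⁆)
  bigStar-accepts⇒part-accepts zero F plott Xs A split e e∈X e∉A e∈ = ⊥-elim (∉⊥ e∈)
  bigStar-accepts⇒part-accepts (suc q) F plott Xs A split e e∈X e∉A e∈
    with e ∈? F zero (Xs zero ∪ ⁅ e ⁆)
  ... | yes e∈F₀ = zero , e∈F₀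
  ... | no e∉F₀ with x∈p∪q⁻ _ _ e∈
  ...   | inj₁ e∈F₀ = ⊥-elim (e∉F₀ (subst (e ∈_) (F₀[A∪e]≡F₀[X₀∪e] F plott Xs A split e e∈X e∉A) e∈F₀))
  ...   | inj₂ e∈rest with bigStar-accepts⇒part-accepts q (tail F) (λ j → plott (suc j)) (tail Xs)
                             (A ─ Xs zero) (tail-splitting F plott Xs A split) e e∈X
                             (e∉A─X₀ F plott Xs A split e e∈X e∉A)
                             (subst (λ Z → e ∈ bigStar q (tail F) Z)
                                (rest-after-rejection F plott Xs A split e e∈X e∉A e∉F₀) e∈rest)
  ...     | j , e∈Fj = suc j , e∈Fj

  part-accepts⇒bigStar-accepts : ∀ q (F : Fin q → CF n) → (∀ j → Plott X (F j)) → ∀ Xs A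
    → StarSplitting X F Xs A → ∀ e → e ∈ X → e ∉ A
    → ∀ j → e ∈ F j (Xs j ∪ ⁅ e ⁆) → e ∈ bigStar q F (A ∪ ⁅ e ⁆)
  part-accepts⇒bigStar-accepts (suc q) F plott Xs A split e e∈X e∉A j e∈Fj
    with e ∈? F zero (Xs zero ∪ ⁅ e ⁆)
  ... | yes e∈F₀ = p⊆p∪q _ (subst (e ∈_) (sym (F₀[A∪e]≡F₀[X₀∪e] F plott Xs A split e e∈X e∉A)) e∈F₀)
  part-accepts⇒bigStar-accepts (suc q) F plott Xs A split e e∈X e∉A zero e∈F₀ | no e∉F₀ =
    ⊥-elim (e∉F₀ e∈F₀)
  part-accepts⇒bigStar-accepts (suc q) F plott Xs A split e e∈X e∉A (suc j) e∈Fj | no e∉F₀ =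
    q⊆p∪q _ _ (subst (λ Z → e ∈ bigStar q (tail F) Z)
                 (sym (rest-after-rejection F plott Xs A split e e∈X e∉A e∉F₀))
                 (part-accepts⇒bigStar-accepts q (tail F) (λ j → plott (suc j)) (tail Xs) (A ─ Xs zero)
                    (tail-splitting F plott Xs A split) e e∈X (e∉A─X₀ F plott Xs A split e e∈X e∉A) j e∈Fj))

-- Problems in which every contract has at most one participant

-- Nobody competes for a contract, so the only stable set consists of the
-- contracts that each participant chooses from everything available to it.
module AtMostOneParticipant (J : Problem)
    (one-participant : ∀ e a b → a ∈ P J e → b ∈ P J e → a ≡ b) where

  Chosen : Fin (nE J) → Set
  Chosen e = ∀ a → a ∈ P J e → e ∈ C J a (E[_] J a)

  canonical : Subset (nE J)
  canonical = select (λ e → Fin.all? λ a → (a ∈? P J e) →-dec (e ∈? C J a (E[_] J a)))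

  ∈-canonical⁺ : ∀ {e} → Chosen e → e ∈ canonical
  ∈-canonical⁺ = ∈-select⁺ _

  ∈-canonical⁻ : ∀ {e} → e ∈ canonical → Chosen e
  ∈-canonical⁻ = ∈-select⁻ _

  stable⇒≡canonical : ∀ S → Stable J S → S ≡ canonical
  stable⇒≡canonical S (fixed , closed) = ⊆-antisym S⊆canonical canonical⊆S
    where
      C[E]≡S∩E : ∀ a → C J a (E[_] J a) ≡ S ∩ E[_] J a
      C[E]≡S∩E a = PlottCF.fixed∧rejecting⇒C≡ (plott J a) (E[_] J a) (S ∩ E[_] J a) (λ x∈ → x∈)
                     (p∩q⊆q S _) (fixed a) rejects
        where
          rejects : ∀ f → f ∈ E[_] J a → f ∉ S ∩ E[_] J a → f ∉ C J a ((S ∩ E[_] J a) ∪ ⁅ f ⁆)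
          rejects f f∈E f∉ f∈C = f∉ (x∈p∩q⁺ (closed f accepted , f∈E))
            where
              accepted : ∀ b → b ∈ P J f → f ∈ C J b ((S ∩ E[_] J b) ∪ ⁅ f ⁆)
              accepted b b∈ = subst (λ b → f ∈ C J b ((S ∩ E[_] J b) ∪ ⁅ f ⁆))
                                (one-participant f a b (∈-Eof⁻ (P J) f∈E) b∈) f∈C
      S⊆canonical : S ⊆ canonical
      S⊆canonical {e} e∈S = ∈-canonical⁺ λ a a∈ →
        subst (e ∈_) (sym (C[E]≡S∩E a)) (x∈p∩q⁺ (e∈S , ∈-Eof⁺ (P J) a∈))
      canonical⊆S : canonical ⊆ S
      canonical⊆S {e} e∈ with e ∈? S
      ... | yes e∈S = e∈S
      ... | no e∉S = closed e λ a a∈ →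
            ⊥-elim (e∉S (p∩q⊆p S _ (subst (e ∈_) (C[E]≡S∩E a) (∈-canonical⁻ e∈ a a∈))))

  canonical∩E≡C[E] : ∀ a → canonical ∩ E[_] J a ≡ C J a (E[_] J a)
  canonical∩E≡C[E] a = ⊆-antisym to from
    where
      to : canonical ∩ E[_] J a ⊆ C J a (E[_] J a)
      to e∈ = ∈-canonical⁻ (p∩q⊆p canonical _ e∈) a (∈-Eof⁻ (P J) (p∩q⊆q canonical _ e∈))
      from : C J a (E[_] J a) ⊆ canonical ∩ E[_] J a
      from {e} e∈C = x∈p∩q⁺ (∈-canonical⁺ chosen , e∈E)
        where
          e∈E = proj₁ (plott J a) (E[_] J a) (λ x∈ → x∈) e∈C
          chosen : Chosen e
          chosen b b∈ = subst (λ b → e ∈ C J b (E[_] J b)) (one-participant e a b (∈-Eof⁻ (P J) e∈E) b∈) e∈C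

  canonical-stable : Stable J canonical
  canonical-stable = fixed , closed
    where
      fixed : ∀ a → C J a (canonical ∩ E[_] J a) ≡ canonical ∩ E[_] J a
      fixed a rewrite canonical∩E≡C[E] a = PlottCF.C-idem (plott J a) (E[_] J a) (λ x∈ → x∈)
      closed : ∀ e → (∀ a → a ∈ P J e → e ∈ C J a ((canonical ∩ E[_] J a) ∪ ⁅ e ⁆)) → e ∈ canonical
      closed e accepted = ∈-canonical⁺ λ a a∈ →
        let open PlottCF (plott J a)
            C[E]⊆E = proj₁ (plott J a) (E[_] J a) (λ x∈ → x∈)
        in subst (e ∈_) (C≡-between (E[_] J a) (C J a (E[_] J a) ∪ ⁅ e ⁆) (C J a (E[_] J a)) (λ x∈ → x∈) refl
                          (p⊆p∪q _) (∪⁅⁆-⊆ C[E]⊆E (∈-Eof⁺ (P J) a∈)))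
             (subst (λ Z → e ∈ C J a (Z ∪ ⁅ e ⁆)) (canonical∩E≡C[E] a) (accepted a a∈))

∑ : ∀ {k} → (Fin k → ℕ) → ℕ
∑ = foldr _+_ 0

ΣFin : ∀ k → (Fin k → ℕ) → Set
ΣFin k m = Σ (Fin k) λ i → Fin (m i)

encode : ∀ k (m : Fin k → ℕ) → ΣFin k m → Fin (∑ m)
encode (suc k) m (zero  , j) = j ↑ˡ ∑ (tail m)
encode (suc k) m (suc i , j) = m zero ↑ʳ encode k (tail m) (i , j)

decode : ∀ k (m : Fin k → ℕ) → Fin (∑ m) → ΣFin k m
decode⊎ : ∀ k (m : Fin (suc k) → ℕ) → Fin (m zero) ⊎ Fin (∑ (tail m)) → ΣFin (suc k) m
decode (suc k) m x = decode⊎ k m (splitAt (m zero) x)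
decode⊎ k m (inj₁ j) = zero , j
decode⊎ k m (inj₂ y) = suc (proj₁ (decode k (tail m) y)) , proj₂ (decode k (tail m) y)

decode∘encode : ∀ k m p → decode k m (encode k m p) ≡ p
decode∘encode (suc k) m (zero , j) rewrite Fin.splitAt-↑ˡ (m zero) j (∑ (tail m)) = refl
decode∘encode (suc k) m (suc i , j)
  rewrite Fin.splitAt-↑ʳ (m zero) (∑ (tail m)) (encode k (tail m) (i , j))
        | decode∘encode k (tail m) (i , j) = refl

encode∘decode : ∀ k m x → encode k m (decode k m x) ≡ x
encode∘decode (suc k) m x = trans (encode∘decode⊎ (splitAt (m zero) x)) (Fin.join-splitAt (m zero) _ x)
  where
    encode∘decode⊎ : ∀ s → encode (suc k) m (decode⊎ k m s) ≡ join (m zero) _ s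
    encode∘decode⊎ (inj₁ j) = refl
    encode∘decode⊎ (inj₂ y) = cong (m zero ↑ʳ_) (encode∘decode k (tail m) y)

decode-injective : ∀ k m {x y} → decode k m x ≡ decode k m y → x ≡ y
decode-injective k m {x} {y} eq =
  trans (sym (encode∘decode k m x)) (trans (cong (encode k m) eq) (encode∘decode k m y))

ΣFin-≡ : ∀ {k m} {p p′ : ΣFin k m} → proj₁ p ≡ proj₁ p′ → toℕ (proj₂ p) ≡ toℕ (proj₂ p′) → p ≡ p′
ΣFin-≡ {p = i , j} {.i , j′} refl eq = cong (i ,_) (Fin.toℕ-injective eq)

-- The split problem

-- Contract x of the new problem is copy number idxE x of the contract πE x;
-- copies from `copies e` on are spare copies without participants.  Agent b
-- is clone number idxA b of πA b.  The clone w(j) of w ∈ W takes part in the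
-- copies number j of the contracts of w, with choice function C_{w(j)}.  The
-- single clone of m ∉ W takes part in every non-spare copy and accepts only
-- the first available copy of each contract; this keeps at most one copy of
-- each contract in a stable set.
module Split (I : Problem) (W : Subset (nA I))
    (unconnected : ∀ e → ∣ P I e ∩ W ∣ ≤ 1)
    (q : Fin (nA I) → ℕ) (Cw : (w : Fin (nA I)) → Fin (q w) → CF (nE I))
    (Cw-plott : ∀ w → w ∈ W → ∀ j → Plott (E[_] I w) (Cw w j))
    (spare : Fin (nE I) → ℕ) where

  Pᴵ : Fin (nE I) → Subset (nA I)
  Pᴵ = P I
  Cᴵ : Fin (nA I) → CF (nE I)
  Cᴵ = C I
  Eᴵ : Fin (nA I) → Subset (nE I)
  Eᴵ = E[_] I

  W-participant-unique : ∀ e a b → a ∈ Pᴵ e → a ∈ W → b ∈ Pᴵ e → b ∈ W → a ≡ b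
  W-participant-unique e a b a∈P a∈W b∈P b∈W =
    ∣p∣≤1⇒x≡y (Pᴵ e ∩ W) (unconnected e) (x∈p∩q⁺ (a∈P , a∈W)) (x∈p∩q⁺ (b∈P , b∈W))

  HasW-participant : Fin (nE I) → Set
  HasW-participant e = Σ (Fin (nA I)) λ a → a ∈ Pᴵ e × a ∈ W

  W-participant? : ∀ e → Dec (HasW-participant e)
  W-participant? e = Fin.any? λ a → (a ∈? Pᴵ e) ×-dec (a ∈? W)

  opaque
    copies : Fin (nE I) → ℕ
    copies e with W-participant? e
    ... | yes (w , _) = q w
    ... | no _        = 1

    copies≡q : ∀ e w → w ∈ Pᴵ e → w ∈ W → copies e ≡ q w
    copies≡q e w w∈P w∈W with W-participant? e
    ... | yes (w′ , w′∈P , w′∈W) = cong q (W-participant-unique e w′ w w′∈P w′∈W w∈P w∈W)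
    ... | no none = ⊥-elim (none (w , w∈P , w∈W))

    copies≡1 : ∀ e → ¬ HasW-participant e → copies e ≡ 1
    copies≡1 e none with W-participant? e
    ... | yes some = ⊥-elim (none some)
    ... | no _     = refl

  slots : Fin (nE I) → ℕ
  slots e = copies e + spare e

  clones-by : ∀ a → Dec (a ∈ W) → ℕ
  clones-by a (yes _) = q a
  clones-by a (no _)  = 1

  clones : Fin (nA I) → ℕ
  clones a = clones-by a (a ∈? W)

  nA~ nE~ : ℕ
  nA~ = ∑ clones
  nE~ = ∑ slots

  πA : Fin nA~ → Fin (nA I)
  πA b = proj₁ (decode _ clones b)
  idxA : Fin nA~ → ℕ
  idxA b = toℕ (proj₂ (decode _ clones b))
  πE : Fin nE~ → Fin (nE I)
  πE x = proj₁ (decode _ slots x)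
  idxE : Fin nE~ → ℕ
  idxE x = toℕ (proj₂ (decode _ slots x))

  agent-≡ : ∀ b b′ → πA b ≡ πA b′ → idxA b ≡ idxA b′ → b ≡ b′
  agent-≡ b b′ π≡ idx≡ = decode-injective _ clones (ΣFin-≡ π≡ idx≡)

  contract-≡ : ∀ x y → πE x ≡ πE y → idxE x ≡ idxE y → x ≡ y
  contract-≡ x y π≡ idx≡ = decode-injective _ slots (ΣFin-≡ π≡ idx≡)

  idxE<slots : ∀ x → idxE x < slots (πE x)
  idxE<slots x = Fin.toℕ<n (proj₂ (decode _ slots x))

  idxA<clones : ∀ b → idxA b < clones (πA b)
  idxA<clones b = Fin.toℕ<n (proj₂ (decode _ clones b))

  clones-W : ∀ a → a ∈ W → clones a ≡ q a
  clones-W a a∈W with a ∈? W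
  ... | yes _   = refl
  ... | no a∉W = ⊥-elim (a∉W a∈W)

  clones-M : ∀ a → a ∉ W → clones a ≡ 1
  clones-M a a∉W with a ∈? W
  ... | yes a∈W = ⊥-elim (a∉W a∈W)
  ... | no _    = refl

  idxA≡0-on-M : ∀ b → πA b ∉ W → idxA b ≡ 0
  idxA≡0-on-M b b∉W = ℕ.n<1⇒n≡0 (subst (idxA b <_) (clones-M (πA b) b∉W) (idxA<clones b))

  Participates : Fin nA~ → Fin nE~ → Set
  Participates b x = idxE x < copies (πE x)
                   × (πA b ∉ W ⊎ (πA b ∈ Pᴵ (πE x) × idxA b ≡ idxE x))

  participates? : ∀ x b → Dec (Participates b x)
  participates? x b = (idxE x ℕ.<? copies (πE x))
    ×-dec (¬? (πA b ∈? W) ⊎-dec ((πA b ∈? Pᴵ (πE x)) ×-dec (idxA b ℕ.≟ idxE x)))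

  P~ : Fin nE~ → Subset nA~
  P~ x = select (participates? x)

  E~ : Fin nA~ → Subset nE~
  E~ = Eof P~

  ∈P~⁺ : ∀ {b x} → Participates b x → b ∈ P~ x
  ∈P~⁺ = ∈-select⁺ _
  ∈P~⁻ : ∀ {b x} → b ∈ P~ x → Participates b x
  ∈P~⁻ = ∈-select⁻ _
  ∈E~⁺ : ∀ {b x} → Participates b x → x ∈ E~ b
  ∈E~⁺ p = ∈-Eof⁺ P~ (∈P~⁺ p)
  ∈E~⁻ : ∀ {b x} → x ∈ E~ b → Participates b x
  ∈E~⁻ x∈ = ∈P~⁻ (∈-Eof⁻ P~ x∈)

  img : Subset nE~ → Subset (nE I)
  img = image πE

  cloneCF : (w : Fin (nA I)) → Fin (q w) → CF nE~
  cloneCF w j A = select λ x → (x ∈? A) ×-dec (πE x ∈? Cw w j (img A))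

  FirstCopy : Subset nE~ → Fin nE~ → Set
  FirstCopy A x = ∀ y → y ∈ A → πE y ≡ πE x → idxE x ≤ idxE y

  first-copy? : ∀ A x → Dec (FirstCopy A x)
  first-copy? A x = Fin.all? λ y → (y ∈? A) →-dec ((πE y Fin.≟ πE x) →-dec (idxE x ℕ.≤? idxE y))

  Approved : Fin (nA I) → Subset nE~ → Fin nE~ → Set
  Approved m A x = m ∈ Pᴵ (πE x) → πE x ∈ Cᴵ m (img A ∩ Eᴵ m)

  approved? : ∀ m A x → Dec (Approved m A x)
  approved? m A x = (m ∈? Pᴵ (πE x)) →-dec (πE x ∈? Cᴵ m (img A ∩ Eᴵ m))

  firstCopyCF : Fin (nA I) → CF nE~
  firstCopyCF m A = select λ x → (x ∈? A) ×-dec (first-copy? A x ×-dec approved? m A x)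

  choice-by : ∀ a (d : Dec (a ∈ W)) → Fin (clones-by a d) → CF nE~
  choice-by a (yes _) j = cloneCF a j
  choice-by a (no _)  _ = firstCopyCF a

  opaque
    C~ : Fin nA~ → CF nE~
    C~ b = choice (decode _ clones b)
      where
        choice : ΣFin _ clones → CF nE~
        choice (a , j) = choice-by a (a ∈? W) j

  clone-index : ∀ w (d : Dec (w ∈ W)) → w ∈ W → Fin (q w) → Fin (clones-by w d)
  clone-index w (yes _)   _   j = j
  clone-index w (no w∉W) w∈W _ = ⊥-elim (w∉W w∈W)

  toℕ-clone-index : ∀ w d w∈W j → toℕ (clone-index w d w∈W j) ≡ toℕ j
  toℕ-clone-index w (yes _)   _   j = refl
  toℕ-clone-index w (no w∉W) w∈W j = ⊥-elim (w∉W w∈W)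

  opaque
    clone : (w : Fin (nA I)) → w ∈ W → Fin (q w) → Fin nA~
    clone w w∈W j = encode _ clones (w , clone-index w (w ∈? W) w∈W j)

    decode-clone : ∀ w w∈W j → decode _ clones (clone w w∈W j) ≡ (w , clone-index w (w ∈? W) w∈W j)
    decode-clone w w∈W j = decode∘encode _ clones _

    clone-π : ∀ w w∈W j → πA (clone w w∈W j) ≡ w
    clone-π w w∈W j = cong proj₁ (decode-clone w w∈W j)

    clone-idx : ∀ w w∈W j → idxA (clone w w∈W j) ≡ toℕ j
    clone-idx w w∈W j =
      trans (cong (λ p → toℕ (proj₂ p)) (decode-clone w w∈W j)) (toℕ-clone-index w (w ∈? W) w∈W j)

  opaque
    unfolding C~
    C~-clone : ∀ w w∈W j → C~ (clone w w∈W j) ≡ cloneCF w j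
    C~-clone w w∈W j rewrite decode-clone w w∈W j = choice-clone (w ∈? W)
      where
        choice-clone : ∀ d → choice-by w d (clone-index w d w∈W j) ≡ cloneCF w j
        choice-clone (yes _)   = refl
        choice-clone (no w∉W) = ⊥-elim (w∉W w∈W)

    C~-M : ∀ b → πA b ∉ W → C~ b ≡ firstCopyCF (πA b)
    C~-M b b∉W with decode _ clones b
    ... | a , j = choice-M (a ∈? W) j
      where
        choice-M : ∀ d j → choice-by a d j ≡ firstCopyCF a
        choice-M (yes a∈W) _ = ⊥-elim (b∉W a∈W)
        choice-M (no _)    _ = refl

  clone-surj : ∀ w w∈W b → πA b ≡ w → Σ (Fin (q w)) λ j → clone w w∈W j ≡ b
  clone-surj w w∈W b πb≡w = j , agent-≡ _ _ (trans (clone-π w w∈W j) (sym πb≡w))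
                                              (trans (clone-idx w w∈W j) (Fin.toℕ-fromℕ< idx<q))
    where
      idx<q : idxA b < q w
      idx<q = subst (idxA b <_) (trans (cong clones πb≡w) (clones-W w w∈W)) (idxA<clones b)
      j = fromℕ< idx<q

  agent-cases : ∀ b → πA b ∉ W ⊎ Σ (πA b ∈ W) λ w∈W → Σ (Fin (q (πA b))) λ j → clone (πA b) w∈W j ≡ b
  agent-cases b with πA b ∈? W
  ... | no b∉W  = inj₁ b∉W
  ... | yes b∈W = inj₂ (b∈W , clone-surj (πA b) b∈W b refl)

  opaque
    slot : ∀ e i → i < slots e → Fin nE~
    slot e i i< = encode _ slots (e , fromℕ< i<)

    slot-π : ∀ e i i< → πE (slot e i i<) ≡ e
    slot-π e i i< = cong proj₁ (decode∘encode _ slots _)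

    slot-idx : ∀ e i i< → idxE (slot e i i<) ≡ i
    slot-idx e i i< = trans (cong (λ p → toℕ (proj₂ p)) (decode∘encode _ slots _)) (Fin.toℕ-fromℕ< _)

  <copies⇒<slots : ∀ {e i} → i < copies e → i < slots e
  <copies⇒<slots {e} i< = ℕ.<-≤-trans i< (ℕ.m≤m+n (copies e) (spare e))

  first-copy-exists : ∀ A x → x ∈ A → Σ (Fin nE~) λ y → y ∈ A × πE y ≡ πE x × FirstCopy A y
  first-copy-exists A x x∈A = descend (suc (idxE x)) x ℕ.≤-refl x∈A
    where
      descend : ∀ n x → idxE x < n → x ∈ A → Σ (Fin nE~) λ y → y ∈ A × πE y ≡ πE x × FirstCopy A y
      descend (suc n) x (s≤s idx≤n) x∈A
        with Fin.any? (λ y → (y ∈? A) ×-dec ((πE y Fin.≟ πE x) ×-dec (idxE y ℕ.<? idxE x)))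
      ... | no none = x , x∈A , refl , λ y y∈A π≡ → ℕ.≮⇒≥ λ lt → none (y , y∈A , π≡ , lt)
      ... | yes (y , y∈A , π≡ , lt) with descend n y (ℕ.<-≤-trans lt idx≤n) y∈A
      ...   | z , z∈A , π≡′ , first = z , z∈A , trans π≡′ π≡ , first

  ∈cloneCF⁺ : ∀ w j A {x} → x ∈ A → πE x ∈ Cw w j (img A) → x ∈ cloneCF w j A
  ∈cloneCF⁺ w j A x∈A chosen = ∈-select⁺ _ (x∈A , chosen)
  ∈cloneCF⁻ : ∀ w j A {x} → x ∈ cloneCF w j A → x ∈ A × πE x ∈ Cw w j (img A)
  ∈cloneCF⁻ w j A = ∈-select⁻ _

  ∈firstCopyCF⁺ : ∀ m A {x} → x ∈ A → FirstCopy A x → Approved m A x → x ∈ firstCopyCF m A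
  ∈firstCopyCF⁺ m A x∈A first approved = ∈-select⁺ _ (x∈A , first , approved)
  ∈firstCopyCF⁻ : ∀ m A {x} → x ∈ firstCopyCF m A → x ∈ A × FirstCopy A x × Approved m A x
  ∈firstCopyCF⁻ m A = ∈-select⁻ _

  cloneCF-plott : ∀ w j → w ∈ W → (Y : Subset nE~) → img Y ⊆ Eᴵ w → Plott Y (cloneCF w j)
  cloneCF-plott w j w∈W Y imgY⊆E = ⊆A , consistent , substitutable
    where
      Cwj-plott : Plott (Eᴵ w) (Cw w j)
      Cwj-plott = Cw-plott w w∈W j
      img⊆E : ∀ A → A ⊆ Y → img A ⊆ Eᴵ w
      img⊆E A A⊆Y e∈ = imgY⊆E (image-mono πE A⊆Y e∈)
      ⊆A : IsCF Y (cloneCF w j)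
      ⊆A A _ x∈ = proj₁ (∈cloneCF⁻ w j A x∈)
      substitutable : Substitutable Y (cloneCF w j)
      substitutable A B A⊆Y B⊆A x∈ with x∈p∩q⁻ _ B x∈
      ... | x∈CA , x∈B = ∈cloneCF⁺ w j B x∈B
            (proj₂ (proj₂ Cwj-plott) (img A) (img B) (img⊆E A A⊆Y) (image-mono πE B⊆A)
               (x∈p∩q⁺ (proj₂ (∈cloneCF⁻ w j A x∈CA) , ∈-image⁺ πE B x∈B refl)))
      consistent : Consistent Y (cloneCF w j)
      consistent A B A⊆Y CA⊆B B⊆A = ⊆-antisym to from
        where
          C[imgA]⊆imgB : Cw w j (img A) ⊆ img B
          C[imgA]⊆imgB e∈ with ∈-image⁻ πE A (proj₁ Cwj-plott (img A) (img⊆E A A⊆Y) e∈)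
          ... | x , x∈A , refl = ∈-image⁺ πE B (CA⊆B (∈cloneCF⁺ w j A x∈A e∈)) refl
          same : Cw w j (img B) ≡ Cw w j (img A)
          same = proj₁ (proj₂ Cwj-plott) (img A) (img B) (img⊆E A A⊆Y) C[imgA]⊆imgB (image-mono πE B⊆A)
          to : cloneCF w j B ⊆ cloneCF w j A
          to {x} x∈ with ∈cloneCF⁻ w j B x∈
          ... | x∈B , chosen = ∈cloneCF⁺ w j A (B⊆A x∈B) (subst (πE x ∈_) same chosen)
          from : cloneCF w j A ⊆ cloneCF w j B
          from {x} x∈ with ∈cloneCF⁻ w j A x∈
          ... | _ , chosen = ∈cloneCF⁺ w j B (CA⊆B x∈) (subst (πE x ∈_) (sym same) chosen)

  firstCopyCF-plott : ∀ m → (Y : Subset nE~) → Plott Y (firstCopyCF m)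
  firstCopyCF-plott m Y = ⊆A , consistent , substitutable
    where
      Cm-plott : Plott (Eᴵ m) (Cᴵ m)
      Cm-plott = plott I m
      offer : Subset nE~ → Subset (nE I)
      offer A = img A ∩ Eᴵ m
      offer-mono : ∀ {A B} → B ⊆ A → offer B ⊆ offer A
      offer-mono {A} {B} B⊆A e∈ =
        x∈p∩q⁺ (image-mono πE B⊆A (p∩q⊆p (img B) _ e∈) , p∩q⊆q (img B) _ e∈)
      ⊆A : IsCF Y (firstCopyCF m)
      ⊆A A _ x∈ = proj₁ (∈firstCopyCF⁻ m A x∈)
      substitutable : Substitutable Y (firstCopyCF m)
      substitutable A B _ B⊆A x∈ with x∈p∩q⁻ _ B x∈
      ... | x∈CA , x∈B with ∈firstCopyCF⁻ m A x∈CA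
      ...   | _ , first , approved = ∈firstCopyCF⁺ m B x∈B (λ y y∈B → first y (B⊆A y∈B))
              λ m∈P → proj₂ (proj₂ Cm-plott) (offer A) (offer B) (p∩q⊆q (img A) _) (offer-mono B⊆A)
                        (x∈p∩q⁺ (approved m∈P , x∈p∩q⁺ (∈-image⁺ πE B x∈B refl , ∈-Eof⁺ Pᴵ m∈P)))
      consistent : Consistent Y (firstCopyCF m)
      consistent A B _ CA⊆B B⊆A = ⊆-antisym to from
        where
          -- each contract chosen from offer A has a first copy in A, which is kept and so lies in B
          C[offerA]⊆offerB : Cᴵ m (offer A) ⊆ offer B
          C[offerA]⊆offerB {e} e∈C with x∈p∩q⁻ (img A) _ (proj₁ Cm-plott (offer A) (p∩q⊆q (img A) _) e∈C)
          ... | e∈imgA , e∈E with ∈-image⁻ πE A e∈imgA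
          ...   | x , x∈A , refl with first-copy-exists A x x∈A
          ...     | y , y∈A , π≡ , first =
                    x∈p∩q⁺ (∈-image⁺ πE B (CA⊆B (∈firstCopyCF⁺ m A y∈A first approved)) π≡ , e∈E)
            where
              approved : Approved m A y
              approved _ = subst (_∈ Cᴵ m (offer A)) (sym π≡) e∈C
          same : Cᴵ m (offer B) ≡ Cᴵ m (offer A)
          same = proj₁ (proj₂ Cm-plott) (offer A) (offer B) (p∩q⊆q (img A) _) C[offerA]⊆offerB (offer-mono B⊆A)
          to : firstCopyCF m B ⊆ firstCopyCF m A
          to {x} x∈ with ∈firstCopyCF⁻ m B x∈
          ... | x∈B , firstB , approvedB with first-copy-exists A x (B⊆A x∈B)
          ...   | y , y∈A , π≡ , firstA = ∈firstCopyCF⁺ m A (B⊆A x∈B) first approved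
            where
              approved : Approved m A x
              approved m∈P = subst (πE x ∈_) same (approvedB m∈P)
              y∈CA : y ∈ firstCopyCF m A
              y∈CA = ∈firstCopyCF⁺ m A y∈A firstA
                       (λ m∈P → subst (_∈ Cᴵ m (offer A)) (sym π≡) (approved (subst (λ e → m ∈ Pᴵ e) π≡ m∈P)))
              first : FirstCopy A x
              first z z∈A π≡′ = ℕ.≤-trans (firstB y (CA⊆B y∈CA) π≡) (firstA z z∈A (trans π≡′ (sym π≡)))
          from : firstCopyCF m A ⊆ firstCopyCF m B
          from {x} x∈ with ∈firstCopyCF⁻ m A x∈
          ... | _ , firstA , approvedA = ∈firstCopyCF⁺ m B (CA⊆B x∈) (λ y y∈B → firstA y (B⊆A y∈B))
                                           (λ m∈P → subst (πE x ∈_) (sym same) (approvedA m∈P))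

  W-participates : ∀ b x → πA b ∈ W → Participates b x → πA b ∈ Pᴵ (πE x) × idxA b ≡ idxE x
  W-participates b x b∈W (_ , inj₁ b∉W) = ⊥-elim (b∉W b∈W)
  W-participates b x b∈W (_ , inj₂ p)   = p

  ∈E~-clone⁻ : ∀ w w∈W j x → x ∈ E~ (clone w w∈W j) → w ∈ Pᴵ (πE x) × toℕ j ≡ idxE x
  ∈E~-clone⁻ w w∈W j x x∈
    with W-participates (clone w w∈W j) x (subst (_∈ W) (sym (clone-π w w∈W j)) w∈W) (∈E~⁻ x∈)
  ... | w∈P , idx≡ = subst (λ v → v ∈ Pᴵ (πE x)) (clone-π w w∈W j) w∈P , trans (sym (clone-idx w w∈W j)) idx≡

  ∈E~-clone⁺ : ∀ w w∈W j x → w ∈ Pᴵ (πE x) → toℕ j ≡ idxE x → x ∈ E~ (clone w w∈W j)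
  ∈E~-clone⁺ w w∈W j x w∈P idx≡ =
    ∈E~⁺ (idx<copies , inj₂ (subst (λ v → v ∈ Pᴵ (πE x)) (sym (clone-π w w∈W j)) w∈P
                             , trans (clone-idx w w∈W j) idx≡))
    where
      idx<copies : idxE x < copies (πE x)
      idx<copies = subst (idxE x <_) (sym (copies≡q (πE x) w w∈P w∈W)) (subst (_< q w) idx≡ (Fin.toℕ<n j))

  img-clone⊆E : ∀ w w∈W j A → A ⊆ E~ (clone w w∈W j) → img A ⊆ Eᴵ w
  img-clone⊆E w w∈W j A A⊆E e∈ with ∈-image⁻ πE A e∈
  ... | x , x∈A , refl = ∈-Eof⁺ Pᴵ (proj₁ (∈E~-clone⁻ w w∈W j x (A⊆E x∈A)))

  C~-plott : ∀ b → Plott (E~ b) (C~ b)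
  C~-plott b with agent-cases b
  ... | inj₁ b∉W rewrite C~-M b b∉W = firstCopyCF-plott (πA b) (E~ b)
  ... | inj₂ (b∈W , j , clone≡b) = subst (λ b → Plott (E~ b) (C~ b)) clone≡b (clone-plott (πA b) b∈W j)
    where
      clone-plott : ∀ w w∈W j → Plott (E~ (clone w w∈W j)) (C~ (clone w w∈W j))
      clone-plott w w∈W j rewrite C~-clone w w∈W j =
        cloneCF-plott w j w∈W (E~ (clone w w∈W j)) (img-clone⊆E w w∈W j _ (λ x∈ → x∈))

  I~ : Problem
  I~ = record { nA = nA~ ; nE = nE~ ; P = P~ ; C = C~ ; plott = C~-plott }

  W~ : Subset nA~
  W~ = select λ b → πA b ∈? W

  πE-into : ∀ w (w∈W : w ∈ W) j x → x ∈ E~ (clone w w∈W j) → πE x ∈ Eᴵ w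
  πE-into w w∈W j x x∈ = ∈-Eof⁺ Pᴵ (proj₁ (∈E~-clone⁻ w w∈W j x x∈))

  πE-inj : ∀ w (w∈W : w ∈ W) j x y → x ∈ E~ (clone w w∈W j) → y ∈ E~ (clone w w∈W j)
         → πE x ≡ πE y → x ≡ y
  πE-inj w w∈W j x y x∈ y∈ π≡ =
    contract-≡ x y π≡ (trans (sym (proj₂ (∈E~-clone⁻ w w∈W j x x∈))) (proj₂ (∈E~-clone⁻ w w∈W j y y∈)))

  clone-copy : ∀ w → w ∈ W → ∀ e → w ∈ Pᴵ e → Fin (q w) → Fin nE~
  clone-copy w w∈W e w∈P j = slot e (toℕ j) (<copies⇒<slots j<copies)
    where
      j<copies : toℕ j < copies e
      j<copies = subst (toℕ j <_) (sym (copies≡q e w w∈P w∈W)) (Fin.toℕ<n j)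

  clone-copy-π : ∀ w w∈W e w∈P j → πE (clone-copy w w∈W e w∈P j) ≡ e
  clone-copy-π w w∈W e w∈P j = slot-π e (toℕ j) _

  clone-copy-idx : ∀ w w∈W e w∈P j → idxE (clone-copy w w∈W e w∈P j) ≡ toℕ j
  clone-copy-idx w w∈W e w∈P j = slot-idx e (toℕ j) _

  clone-copy-∈E~ : ∀ w w∈W e w∈P j → clone-copy w w∈W e w∈P j ∈ E~ (clone w w∈W j)
  clone-copy-∈E~ w w∈W e w∈P j =
    ∈E~-clone⁺ w w∈W j _ (subst (λ e → w ∈ Pᴵ e) (sym (clone-copy-π w w∈W e w∈P j)) w∈P)
      (sym (clone-copy-idx w w∈W e w∈P j))

  πE-surj : ∀ w (w∈W : w ∈ W) j e → e ∈ Eᴵ w → Σ (Fin nE~) λ x → x ∈ E~ (clone w w∈W j) × πE x ≡ e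
  πE-surj w w∈W j e e∈E =
    clone-copy w w∈W e w∈P j , clone-copy-∈E~ w w∈W e w∈P j , clone-copy-π w w∈W e w∈P j
    where w∈P = ∈-Eof⁻ Pᴵ e∈E

  πE-C : ∀ w (w∈W : w ∈ W) j A → A ⊆ E~ (clone w w∈W j) → img (C~ (clone w w∈W j) A) ≡ Cw w j (img A)
  πE-C w w∈W j A A⊆E rewrite C~-clone w w∈W j = ⊆-antisym to from
    where
      to : img (cloneCF w j A) ⊆ Cw w j (img A)
      to e∈ with ∈-image⁻ πE _ e∈
      ... | x , x∈ , refl = proj₂ (∈cloneCF⁻ w j A x∈)
      from : Cw w j (img A) ⊆ img (cloneCF w j A)
      from e∈ with ∈-image⁻ πE A (proj₁ (Cw-plott w w∈W j) (img A) (img-clone⊆E w w∈W j A A⊆E) e∈)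
      ... | x , x∈A , refl = ∈-image⁺ πE _ (∈cloneCF⁺ w j A x∈A e∈) refl

  M-clone-by : ∀ m (d : Dec (m ∈ W)) → m ∉ W → Fin (clones-by m d)
  M-clone-by m (yes m∈W) m∉W = ⊥-elim (m∉W m∈W)
  M-clone-by m (no _)    _   = zero

  opaque
    M-clone : ∀ m → m ∉ W → Fin nA~
    M-clone m m∉W = encode _ clones (m , M-clone-by m (m ∈? W) m∉W)

    M-clone-π : ∀ m m∉W → πA (M-clone m m∉W) ≡ m
    M-clone-π m m∉W = cong proj₁ (decode∘encode _ clones _)

  M-clone-∉W : ∀ m m∉W → πA (M-clone m m∉W) ∉ W
  M-clone-∉W m m∉W = subst (_∉ W) (sym (M-clone-π m m∉W)) m∉W

  W-participant⇒clone : ∀ b x w w∈W (j : Fin (q w)) → πA b ∈ W → Participates b x → w ∈ Pᴵ (πE x)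
                      → toℕ j ≡ idxE x → b ≡ clone w w∈W j
  W-participant⇒clone b x w w∈W j b∈W part w∈P j≡idx with W-participates b x b∈W part
  ... | b∈P , idx≡ = agent-≡ _ _ (trans (W-participant-unique (πE x) (πA b) w b∈P b∈W w∈P w∈W)
                                        (sym (clone-π w w∈W j)))
                                 (trans idx≡ (trans (sym j≡idx) (sym (clone-idx w w∈W j))))

  clone-accepts⁺ : ∀ w w∈W j A x → πE x ∈ Cw w j (img A ∪ ⁅ πE x ⁆) → x ∈ C~ (clone w w∈W j) (A ∪ ⁅ x ⁆)
  clone-accepts⁺ w w∈W j A x accepted rewrite C~-clone w w∈W j =
    ∈cloneCF⁺ w j _ (q⊆p∪q A _ (x∈⁅x⁆ x)) (subst (λ Z → πE x ∈ Cw w j Z) (sym (image-∪⁅⁆ πE A x)) accepted)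

  clone-accepts⁻ : ∀ w w∈W j A x → x ∈ C~ (clone w w∈W j) (A ∪ ⁅ x ⁆) → πE x ∈ Cw w j (img A ∪ ⁅ πE x ⁆)
  clone-accepts⁻ w w∈W j A x accepted rewrite C~-clone w w∈W j =
    subst (λ Z → πE x ∈ Cw w j Z) (image-∪⁅⁆ πE A x) (proj₂ (∈cloneCF⁻ w j _ accepted))

  reduction : (∀ S → Stable I~ S → Stable I (image πE S))
            → (∀ S T → Stable I~ S → Stable I~ T → image πE S ≡ image πE T → S ≡ T)
            → (∀ S → Stable I S → Σ (Subset nE~) λ S~ → Stable I~ S~ × image πE S~ ≡ S)
            → Reduction I W q Cw
  reduction St-into St-inj St-surj = record
    { I~ = I~ ; W~ = W~ ; πA = πA ; πE = πE
    ; πM = λ b b∉W~ b∈W → b∉W~ (∈W~⁺ b∈W)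
    ; πM-inj = λ b b′ b∉W~ b′∉W~ π≡ → agent-≡ b b′ π≡
                 (trans (idxA≡0-on-M b (λ b∈W → b∉W~ (∈W~⁺ b∈W)))
                        (sym (idxA≡0-on-M b′ (λ b′∈W → b′∉W~ (∈W~⁺ b′∈W)))))
    ; πM-surj = λ m m∉W → M-clone m m∉W
                        , (λ m∈W~ → m∉W (subst (_∈ W) (M-clone-π m m∉W) (∈-select⁻ _ m∈W~)))
                        , M-clone-π m m∉W
    ; πW = λ b → ∈-select⁻ _
    ; copy = clone
    ; copy-W = λ w w∈W j → ∈W~⁺ (subst (_∈ W) (sym (clone-π w w∈W j)) w∈W)
    ; copy-π = clone-π
    ; copy-inj = λ w w∈W i j i≡j → Fin.toℕ-injective
                   (trans (sym (clone-idx w w∈W i)) (trans (cong idxA i≡j) (clone-idx w w∈W j)))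
    ; copy-surj = clone-surj
    ; πE-into = πE-into ; πE-inj = πE-inj ; πE-surj = πE-surj ; πE-C = πE-C
    ; St-into = St-into ; St-inj = St-inj ; St-surj = St-surj
    }
    where
      ∈W~⁺ : ∀ {b} → πA b ∈ W → b ∈ W~
      ∈W~⁺ = ∈-select⁺ _

-- The case M ≠ ∅

module SplitWithM (I : Problem) (W : Subset (nA I))
    (unconnected : ∀ e → ∣ P I e ∩ W ∣ ≤ 1)
    (q : Fin (nA I) → ℕ) (Cw : (w : Fin (nA I)) → Fin (q w) → CF (nE I))
    (Cw-plott : ∀ w → w ∈ W → ∀ j → Plott (E[_] I w) (Cw w j))
    (C≡bigStar : ∀ w → w ∈ W → ∀ A → A ⊆ E[_] I w → C I w A ≡ bigStar (q w) (Cw w) A)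
    (m₀ : Fin (nA I)) (m₀∉W : m₀ ∉ W) where

  open Split I W unconnected q Cw Cw-plott (λ _ → 0) public

  idxE<copies : ∀ x → idxE x < copies (πE x)
  idxE<copies x = subst (idxE x <_) (ℕ.+-identityʳ (copies (πE x))) (idxE<slots x)

  M∈P~ : ∀ b → πA b ∉ W → ∀ x → b ∈ P~ x
  M∈P~ b b∉W x = ∈P~⁺ (idxE<copies x , inj₁ b∉W)

  ∩E~-M : ∀ b → πA b ∉ W → ∀ A → A ∩ E~ b ≡ A
  ∩E~-M b b∉W A = ⊆-antisym (p∩q⊆p A _) (λ x∈A → x∈p∩q⁺ (x∈A , ∈-Eof⁺ P~ (M∈P~ b b∉W _)))

  M-accepts⁺ : ∀ b → πA b ∉ W → ∀ A x → FirstCopy (A ∪ ⁅ x ⁆) x → Approved (πA b) (A ∪ ⁅ x ⁆) x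
             → x ∈ C~ b ((A ∩ E~ b) ∪ ⁅ x ⁆)
  M-accepts⁺ b b∉W A x first approved rewrite ∩E~-M b b∉W A | C~-M b b∉W =
    ∈firstCopyCF⁺ (πA b) _ (q⊆p∪q A _ (x∈⁅x⁆ x)) first approved

  M-accepts⁻ : ∀ b → πA b ∉ W → ∀ A x → x ∈ C~ b ((A ∩ E~ b) ∪ ⁅ x ⁆)
             → FirstCopy (A ∪ ⁅ x ⁆) x × Approved (πA b) (A ∪ ⁅ x ⁆) x
  M-accepts⁻ b b∉W A x accepted rewrite ∩E~-M b b∉W A | C~-M b b∉W =
    proj₂ (∈firstCopyCF⁻ (πA b) _ accepted)

  copy-number : ∀ w → w ∈ W → ∀ x → w ∈ Pᴵ (πE x) → Fin (q w)
  copy-number w w∈W x w∈P = fromℕ< (subst (idxE x <_) (copies≡q (πE x) w w∈P w∈W) (idxE<copies x))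

  toℕ-copy-number : ∀ w w∈W x w∈P → toℕ (copy-number w w∈W x w∈P) ≡ idxE x
  toℕ-copy-number w w∈W x w∈P = Fin.toℕ-fromℕ< _

  idxE≡0-without-W : ∀ x → ¬ HasW-participant (πE x) → idxE x ≡ 0
  idxE≡0-without-W x none = ℕ.n<1⇒n≡0 (subst (idxE x <_) (copies≡1 (πE x) none) (idxE<copies x))

  first-copy-without-W : ∀ e → ¬ HasW-participant e → Fin nE~
  first-copy-without-W e none = slot e 0 (<copies⇒<slots (subst (0 <_) (sym (copies≡1 e none)) (s≤s z≤n)))

  first-copy-without-W-π : ∀ e none → πE (first-copy-without-W e none) ≡ e
  first-copy-without-W-π e none = slot-π e 0 _

  b₀ : Fin nA~
  b₀ = M-clone m₀ m₀∉W

  Accepts : Subset nE~ → Fin nE~ → Fin nA~ → Set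
  Accepts S~ x b = x ∈ C~ b ((S~ ∩ E~ b) ∪ ⁅ x ⁆)

  -- The participants of a copy are the M-clones and at most one clone of W.
  accepted-with-clone : ∀ S~ x w w∈W j → w ∈ Pᴵ (πE x) → toℕ j ≡ idxE x
    → (∀ b → πA b ∉ W → Accepts S~ x b) → Accepts S~ x (clone w w∈W j)
    → ∀ b → b ∈ P~ x → Accepts S~ x b
  accepted-with-clone S~ x w w∈W j w∈P j≡ by-M by-clone b b∈P with πA b ∈? W
  ... | no b∉W  = by-M b b∉W
  ... | yes b∈W = subst (Accepts S~ x) (sym (W-participant⇒clone b x w w∈W j b∈W (∈P~⁻ b∈P) w∈P j≡)) by-clone

  accepted-without-W : ∀ S~ x → ¬ HasW-participant (πE x)
    → (∀ b → πA b ∉ W → Accepts S~ x b) → ∀ b → b ∈ P~ x → Accepts S~ x b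
  accepted-without-W S~ x none by-M b b∈P with πA b ∈? W
  ... | no b∉W  = by-M b b∉W
  ... | yes b∈W = ⊥-elim (none (πA b , proj₁ (W-participates b x b∈W (∈P~⁻ b∈P)) , b∈W))

  module Project (S~ : Subset nE~) (stable~ : Stable I~ S~) where

    S : Subset (nE I)
    S = img S~

    firstCopyCF-fixed : ∀ b → πA b ∉ W → firstCopyCF (πA b) S~ ≡ S~
    firstCopyCF-fixed b b∉W = begin
      firstCopyCF (πA b) S~  ≡⟨ cong (λ F → F S~) (C~-M b b∉W) ⟨
      C~ b S~                ≡⟨ cong (C~ b) (∩E~-M b b∉W S~) ⟨
      C~ b (S~ ∩ E~ b)       ≡⟨ proj₁ stable~ b ⟩
      S~ ∩ E~ b              ≡⟨ ∩E~-M b b∉W S~ ⟩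
      S~                     ∎
      where open ≡-Reasoning

    kept-by-M : ∀ b → πA b ∉ W → ∀ x → x ∈ S~ → FirstCopy S~ x × Approved (πA b) S~ x
    kept-by-M b b∉W x x∈ = proj₂ (∈firstCopyCF⁻ (πA b) S~ (subst (x ∈_) (sym (firstCopyCF-fixed b b∉W)) x∈))

    one-copy : ∀ x y → x ∈ S~ → y ∈ S~ → πE x ≡ πE y → x ≡ y
    one-copy x y x∈ y∈ π≡ = contract-≡ x y π≡
      (ℕ.≤-antisym (proj₁ (kept-by-M b₀ (M-clone-∉W m₀ m₀∉W) x x∈) y y∈ (sym π≡))
                   (proj₁ (kept-by-M b₀ (M-clone-∉W m₀ m₀∉W) y y∈) x x∈ π≡))

    fixed-M : ∀ m → m ∉ W → Cᴵ m (S ∩ Eᴵ m) ≡ S ∩ Eᴵ m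
    fixed-M m m∉W = ⊆-antisym (proj₁ (plott I m) _ (p∩q⊆q S _)) S∩E⊆C
      where
        b = M-clone m m∉W
        S∩E⊆C : S ∩ Eᴵ m ⊆ Cᴵ m (S ∩ Eᴵ m)
        S∩E⊆C e∈ with ∈-image⁻ πE S~ (p∩q⊆p S _ e∈)
        ... | x , x∈ , refl =
          subst (λ v → πE x ∈ Cᴵ v (S ∩ Eᴵ v)) (M-clone-π m m∉W)
            (proj₂ (kept-by-M b (M-clone-∉W m m∉W) x x∈)
               (subst (λ v → v ∈ Pᴵ (πE x)) (sym (M-clone-π m m∉W)) (∈-Eof⁻ Pᴵ (p∩q⊆q S _ e∈))))

    part : ∀ w → w ∈ W → Fin (q w) → Subset (nE I)
    part w w∈W j = img (S~ ∩ E~ (clone w w∈W j))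

    ∈part⁻ : ∀ w w∈W j {e} → e ∈ part w w∈W j
           → Σ (Fin nE~) λ x → x ∈ S~ × πE x ≡ e × w ∈ Pᴵ e × toℕ j ≡ idxE x
    ∈part⁻ w w∈W j e∈ with ∈-image⁻ πE _ e∈
    ... | x , x∈ , refl = x , p∩q⊆p S~ _ x∈ , refl , ∈E~-clone⁻ w w∈W j x (p∩q⊆q S~ _ x∈)

    ∈part⁺ : ∀ w w∈W j x → x ∈ S~ → w ∈ Pᴵ (πE x) → toℕ j ≡ idxE x → πE x ∈ part w w∈W j
    ∈part⁺ w w∈W j x x∈ w∈P j≡ = ∈-image⁺ πE _ (x∈p∩q⁺ (x∈ , ∈E~-clone⁺ w w∈W j x w∈P j≡)) refl

    first-copy-∪⁅⁆ : ∀ x → (∀ y → y ∈ S~ → πE y ≡ πE x → idxE x ≤ idxE y) → FirstCopy (S~ ∪ ⁅ x ⁆) x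
    first-copy-∪⁅⁆ x below y y∈ π≡ with x∈p∪q⁻ S~ _ y∈
    ... | inj₁ y∈S~ = below y y∈S~ π≡
    ... | inj₂ y∈x rewrite x∈⁅y⁆⇒x≡y _ y∈x = ℕ.≤-refl

    M-accepts-old : ∀ x → πE x ∈ S → (∀ y → y ∈ S~ → πE y ≡ πE x → idxE x ≤ idxE y)
                  → ∀ b → πA b ∉ W → Accepts S~ x b
    M-accepts-old x πx∈S below b b∉W = M-accepts⁺ b b∉W S~ x (first-copy-∪⁅⁆ x below) approved
      where
        approved : Approved (πA b) (S~ ∪ ⁅ x ⁆) x
        approved b∈P = subst (λ Z → πE x ∈ Cᴵ (πA b) (Z ∩ Eᴵ (πA b)))
                         (sym (trans (image-∪⁅⁆ πE S~ x) (∪⁅⁆-absorb S πx∈S)))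
                         (subst (πE x ∈_) (sym (fixed-M (πA b) b∉W)) (x∈p∩q⁺ (πx∈S , ∈-Eof⁺ Pᴵ b∈P)))

    M-accepts-new : ∀ x e → πE x ≡ e → e ∉ S → (∀ a → a ∈ Pᴵ e → e ∈ Cᴵ a ((S ∩ Eᴵ a) ∪ ⁅ e ⁆))
                  → ∀ b → πA b ∉ W → Accepts S~ x b
    M-accepts-new x _ refl πx∉S accepted b b∉W = M-accepts⁺ b b∉W S~ x (first-copy-∪⁅⁆ x below) approved
      where
        below : ∀ y → y ∈ S~ → πE y ≡ πE x → idxE x ≤ idxE y
        below y y∈ π≡ = ⊥-elim (πx∉S (∈-image⁺ πE S~ y∈ π≡))
        approved : Approved (πA b) (S~ ∪ ⁅ x ⁆) x
        approved b∈P = subst (λ Z → πE x ∈ Cᴵ (πA b) Z)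
                         (sym (trans (cong (_∩ Eᴵ (πA b)) (image-∪⁅⁆ πE S~ x)) (∪⁅⁆-∩ S (Eᴵ (πA b)) (∈-Eof⁺ Pᴵ b∈P))))
                         (accepted (πA b) b∈P)

    clone-copy-∈S~ : ∀ w w∈W e (w∈P : w ∈ Pᴵ e) j → e ∈ Cw w j (part w w∈W j ∪ ⁅ e ⁆)
                   → (∀ b → πA b ∉ W → Accepts S~ (clone-copy w w∈W e w∈P j) b)
                   → clone-copy w w∈W e w∈P j ∈ S~
    clone-copy-∈S~ w w∈W e w∈P j accepted by-M = proj₂ stable~ x
      (accepted-with-clone S~ x w w∈W j (subst (λ e → w ∈ Pᴵ e) (sym πx≡e) w∈P) (sym (clone-copy-idx w w∈W e w∈P j))
         by-M (clone-accepts⁺ w w∈W j _ x (subst (λ e → e ∈ Cw w j (part w w∈W j ∪ ⁅ e ⁆)) (sym πx≡e) accepted)))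
      where
        x = clone-copy w w∈W e w∈P j
        πx≡e = clone-copy-π w w∈W e w∈P j

    -- Otherwise the earlier copy of e would be accepted by everybody, hence in S~ next to the later one.
    rejects-later′ : ∀ w w∈W j j′ e → e ∈ part w w∈W j′ → toℕ j < toℕ j′ → e ∉ Cw w j (part w w∈W j ∪ ⁅ e ⁆)
    rejects-later′ w w∈W j j′ e e∈ j<j′ accepted with ∈part⁻ w w∈W j′ e∈
    ... | y , y∈ , refl , w∈P , j′≡ = ℕ.<-irrefl (cong idxE x≡y) (subst₂ _<_ (sym idx-x) j′≡ j<j′)
      where
        x = clone-copy w w∈W (πE y) w∈P j
        idx-x = clone-copy-idx w w∈W (πE y) w∈P j
        π-x = clone-copy-π w w∈W (πE y) w∈P j
        below : ∀ y′ → y′ ∈ S~ → πE y′ ≡ πE x → idxE x ≤ idxE y′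
        below y′ y′∈ π≡ rewrite one-copy y′ y y′∈ y∈ (trans π≡ π-x) = ℕ.<⇒≤ (subst₂ _<_ (sym idx-x) j′≡ j<j′)
        x∈ : x ∈ S~
        x∈ = clone-copy-∈S~ w w∈W (πE y) w∈P j accepted
               (M-accepts-old x (subst (_∈ S) (sym π-x) (∈-image⁺ πE S~ y∈ refl)) below)
        x≡y : x ≡ y
        x≡y = one-copy x y x∈ y∈ π-x

    splitting : ∀ w (w∈W : w ∈ W) → StarSplitting (Eᴵ w) (Cw w) (part w w∈W) (S ∩ Eᴵ w)
    splitting w w∈W = record
      { ⊆X = p∩q⊆q S _ ; covers = covers′ ; part⊆ = part⊆′ ; part-fixed = part-fixed′
      ; disjoint = disjoint′ ; rejects-later = λ j j′ e → rejects-later′ w w∈W j j′ e }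
      where
        covers′ : ∀ e → e ∈ S ∩ Eᴵ w → Σ (Fin (q w)) λ j → e ∈ part w w∈W j
        covers′ e e∈ with ∈-image⁻ πE S~ (p∩q⊆p S _ e∈)
        ... | x , x∈ , refl = copy-number w w∈W x w∈P , ∈part⁺ w w∈W _ x x∈ w∈P (toℕ-copy-number w w∈W x w∈P)
          where w∈P = ∈-Eof⁻ Pᴵ (p∩q⊆q S _ e∈)
        part⊆′ : ∀ j → part w w∈W j ⊆ S ∩ Eᴵ w
        part⊆′ j e∈ with ∈part⁻ w w∈W j e∈
        ... | x , x∈ , refl , w∈P , _ = x∈p∩q⁺ (∈-image⁺ πE S~ x∈ refl , ∈-Eof⁺ Pᴵ w∈P)
        part-fixed′ : ∀ j → Cw w j (part w w∈W j) ≡ part w w∈W j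
        part-fixed′ j = trans (sym (πE-C w w∈W j _ (p∩q⊆q S~ _))) (cong img (proj₁ stable~ (clone w w∈W j)))
        disjoint′ : ∀ i j e → e ∈ part w w∈W i → e ∈ part w w∈W j → i ≡ j
        disjoint′ i j e e∈i e∈j with ∈part⁻ w w∈W i e∈i | ∈part⁻ w w∈W j e∈j
        ... | x , x∈ , πx≡ , _ , i≡ | y , y∈ , πy≡ , _ , j≡
          rewrite one-copy x y x∈ y∈ (trans πx≡ (sym πy≡)) = Fin.toℕ-injective (trans i≡ (sym j≡))

    fixed-W : ∀ w → w ∈ W → Cᴵ w (S ∩ Eᴵ w) ≡ S ∩ Eᴵ w
    fixed-W w w∈W = trans (C≡bigStar w w∈W _ (p∩q⊆q S _))
      (splitting⇒bigStar-fixed (Eᴵ w) (q w) (Cw w) (Cw-plott w w∈W) (part w w∈W) _ (splitting w w∈W))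

    closed : ∀ e → (∀ a → a ∈ Pᴵ e → e ∈ Cᴵ a ((S ∩ Eᴵ a) ∪ ⁅ e ⁆)) → e ∈ S
    closed e accepted with e ∈? S
    ... | yes e∈S = e∈S
    ... | no e∉S with W-participant? e
    ...   | yes (w , w∈P , w∈W) with bigStar-accepts⇒part-accepts (Eᴵ w) (q w) (Cw w) (Cw-plott w w∈W)
               (part w w∈W) (S ∩ Eᴵ w) (splitting w w∈W) e (∈-Eof⁺ Pᴵ w∈P) (λ e∈ → e∉S (p∩q⊆p S _ e∈))
               (subst (e ∈_) (C≡bigStar w w∈W _ (∪⁅⁆-⊆ (p∩q⊆q S _) (∈-Eof⁺ Pᴵ w∈P))) (accepted w w∈P))
    ...     | j , accepted-j = ⊥-elim (e∉S (∈-image⁺ πE S~ x∈ π-x))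
      where
        x = clone-copy w w∈W e w∈P j
        π-x = clone-copy-π w w∈W e w∈P j
        x∈ : x ∈ S~
        x∈ = clone-copy-∈S~ w w∈W e w∈P j accepted-j
               (M-accepts-new x e π-x e∉S accepted)
    closed e accepted | no e∉S | no none = ⊥-elim (e∉S (∈-image⁺ πE S~ x∈ π-x))
      where
        x = first-copy-without-W e none
        π-x = first-copy-without-W-π e none
        x∈ : x ∈ S~
        x∈ = proj₂ stable~ x (accepted-without-W S~ x (subst (λ v → ¬ HasW-participant v) (sym π-x) none)
               (M-accepts-new x e π-x e∉S accepted))

    stable : Stable I S
    stable = fixed , closed
      where
        fixed : ∀ a → Cᴵ a (S ∩ Eᴵ a) ≡ S ∩ Eᴵ a
        fixed a with a ∈? W
        ... | yes a∈W = fixed-W a a∈W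
        ... | no a∉W  = fixed-M a a∉W

  projection-⊆ : ∀ S~ T~ → Stable I~ S~ → Stable I~ T~ → img S~ ≡ img T~ → S~ ⊆ T~
  projection-⊆ S~ T~ stableS stableT img≡ {x} x∈ with W-participant? (πE x)
  ... | no none with ∈-image⁻ πE T~ (subst (πE x ∈_) img≡ (∈-image⁺ πE S~ x∈ refl))
  ...   | y , y∈ , π≡ = subst (_∈ T~) (contract-≡ y x π≡ idx≡) y∈
    where
      idx≡ : idxE y ≡ idxE x
      idx≡ = trans (idxE≡0-without-W y (subst (λ v → ¬ HasW-participant v) (sym π≡) none))
                   (sym (idxE≡0-without-W x none))
  projection-⊆ S~ T~ stableS stableT img≡ {x} x∈ | yes (w , w∈P , w∈W) =
    same-copy (T.∈part⁻ w w∈W j (subst (πE x ∈_) (same-parts j) (S.∈part⁺ w w∈W j x x∈ w∈P j≡)))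
    where
      module S = Project S~ stableS
      module T = Project T~ stableT
      j = copy-number w w∈W x w∈P
      j≡ = toℕ-copy-number w w∈W x w∈P
      T-splitting : StarSplitting (Eᴵ w) (Cw w) (T.part w w∈W) (img S~ ∩ Eᴵ w)
      T-splitting = subst (λ Z → StarSplitting (Eᴵ w) (Cw w) (T.part w w∈W) (Z ∩ Eᴵ w)) (sym img≡)
                      (T.splitting w w∈W)
      same-parts : ∀ j → S.part w w∈W j ≡ T.part w w∈W j
      same-parts = splitting-unique (Eᴵ w) (q w) (Cw w) (Cw-plott w w∈W) _ _ _ (S.splitting w w∈W) T-splitting
      same-copy : (Σ (Fin nE~) λ y → y ∈ T~ × πE y ≡ πE x × w ∈ Pᴵ (πE x) × toℕ j ≡ idxE y) → x ∈ T~
      same-copy (y , y∈ , π≡ , _ , j≡′) = subst (_∈ T~) (contract-≡ y x π≡ (trans (sym j≡′) j≡)) y∈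

  module Lift (S : Subset (nE I)) (stable : Stable I S) where

    bigStar-fixed : ∀ w → w ∈ W → bigStar (q w) (Cw w) (S ∩ Eᴵ w) ≡ S ∩ Eᴵ w
    bigStar-fixed w w∈W = trans (sym (C≡bigStar w w∈W _ (p∩q⊆q S _))) (proj₁ stable w)

    -- Defined by cases on w ∈? W so that the parts do not depend on the proof of w ∈ W.
    opaque
      parts-by : ∀ w → Dec (w ∈ W) → Fin (q w) → Subset (nE I)
      parts-by w (yes w∈W) =
        proj₁ (bigStar-fixed⇒splitting (Eᴵ w) (q w) (Cw w) (Cw-plott w w∈W) _ (p∩q⊆q S _) (bigStar-fixed w w∈W))
      parts-by w (no _) _ = ∅

      splitting-by : ∀ w d → w ∈ W → StarSplitting (Eᴵ w) (Cw w) (parts-by w d) (S ∩ Eᴵ w)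
      splitting-by w (yes w∈W) _ =
        proj₂ (bigStar-fixed⇒splitting (Eᴵ w) (q w) (Cw w) (Cw-plott w w∈W) _ (p∩q⊆q S _) (bigStar-fixed w w∈W))
      splitting-by w (no w∉W) w∈W = ⊥-elim (w∉W w∈W)

    part : ∀ w → Fin (q w) → Subset (nE I)
    part w = parts-by w (w ∈? W)

    splitting : ∀ w → w ∈ W → StarSplitting (Eᴵ w) (Cw w) (part w) (S ∩ Eᴵ w)
    splitting w = splitting-by w (w ∈? W)

    -- The copy of e ∈ S in S~ is the one whose number is that of the part of e.
    Selected : Fin nE~ → Set
    Selected x = ∀ w → w ∈ W → w ∈ Pᴵ (πE x) → ∀ (j : Fin (q w)) → toℕ j ≡ idxE x → πE x ∈ part w j

    S~ : Subset nE~
    S~ = select λ x → (πE x ∈? S) ×-dec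
           Fin.all? (λ w → (w ∈? W) →-dec ((w ∈? Pᴵ (πE x)) →-dec
             Fin.all? (λ j → (toℕ j ℕ.≟ idxE x) →-dec (πE x ∈? part w j))))

    ∈S~⁺ : ∀ {x} → πE x ∈ S → Selected x → x ∈ S~
    ∈S~⁺ πx∈S selected = ∈-select⁺ _ (πx∈S , selected)

    ∈S~⁻ : ∀ {x} → x ∈ S~ → πE x ∈ S × Selected x
    ∈S~⁻ = ∈-select⁻ _

    ∈part-transport : ∀ {e w w′} {j : Fin (q w)} {j′ : Fin (q w′)} → w ≡ w′ → toℕ j ≡ toℕ j′
                    → e ∈ part w j → e ∈ part w′ j′
    ∈part-transport {j = j} {j′} refl j≡j′ e∈ rewrite Fin.toℕ-injective {i = j} {j = j′} j≡j′ = e∈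

    clone-copy-∈S~ : ∀ w w∈W e w∈P j → e ∈ part w j → clone-copy w w∈W e w∈P j ∈ S~
    clone-copy-∈S~ w w∈W e w∈P j e∈ = ∈S~⁺ (subst (_∈ S) (sym π-x) (p∩q⊆p S _ (part⊆ (splitting w w∈W) j e∈)))
      λ w′ w′∈W w′∈P j′ j′≡ → subst (λ v → v ∈ part w′ j′) (sym π-x)
        (∈part-transport (W-participant-unique e w w′ w∈P w∈W (subst (λ v → w′ ∈ Pᴵ v) π-x w′∈P) w′∈W)
           (trans (sym (clone-copy-idx w w∈W e w∈P j)) (sym j′≡)) e∈)
      where π-x = clone-copy-π w w∈W e w∈P j

    one-copy : ∀ x y → x ∈ S~ → y ∈ S~ → πE x ≡ πE y → x ≡ y
    one-copy x y x∈ y∈ π≡ with W-participant? (πE x)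
    ... | no none = contract-≡ x y π≡
          (trans (idxE≡0-without-W x none)
                 (sym (idxE≡0-without-W y (subst (λ v → ¬ HasW-participant v) π≡ none))))
    ... | yes (w , w∈P , w∈W) = contract-≡ x y π≡
          (trans (sym (toℕ-copy-number w w∈W x w∈P))
                 (trans (cong toℕ same-part) (toℕ-copy-number w w∈W y w∈P′)))
      where
        w∈P′ = subst (λ v → w ∈ Pᴵ v) π≡ w∈P
        in-x : πE x ∈ part w (copy-number w w∈W x w∈P)
        in-x = proj₂ (∈S~⁻ x∈) w w∈W w∈P _ (toℕ-copy-number w w∈W x w∈P)
        in-y : πE x ∈ part w (copy-number w w∈W y w∈P′)
        in-y = subst (λ v → v ∈ part w (copy-number w w∈W y w∈P′)) (sym π≡) (proj₂ (∈S~⁻ y∈) w w∈W w∈P′ _ (toℕ-copy-number w w∈W y w∈P′))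
        same-part : copy-number w w∈W x w∈P ≡ copy-number w w∈W y w∈P′
        same-part = disjoint (splitting w w∈W) _ _ (πE x) in-x in-y

    img-S~ : img S~ ≡ S
    img-S~ = ⊆-antisym to from
      where
        to : img S~ ⊆ S
        to e∈ with ∈-image⁻ πE S~ e∈
        ... | x , x∈ , refl = proj₁ (∈S~⁻ x∈)
        from : S ⊆ img S~
        from {e} e∈S with W-participant? e
        ... | yes (w , w∈P , w∈W) with covers (splitting w w∈W) e (x∈p∩q⁺ (e∈S , ∈-Eof⁺ Pᴵ w∈P))
        ...   | j , e∈part = ∈-image⁺ πE S~ (clone-copy-∈S~ w w∈W e w∈P j e∈part) (clone-copy-π w w∈W e w∈P j)
        from {e} e∈S | no none = ∈-image⁺ πE S~ (∈S~⁺ (subst (_∈ S) (sym π-x) e∈S) not-W) π-x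
          where
            π-x = first-copy-without-W-π e none
            not-W : Selected (first-copy-without-W e none)
            not-W w w∈W w∈P _ _ = ⊥-elim (none (w , subst (λ v → w ∈ Pᴵ v) π-x w∈P , w∈W))

    img-clone-S~ : ∀ w w∈W j → img (S~ ∩ E~ (clone w w∈W j)) ≡ part w j
    img-clone-S~ w w∈W j = ⊆-antisym to from
      where
        to : img (S~ ∩ E~ (clone w w∈W j)) ⊆ part w j
        to e∈ with ∈-image⁻ πE _ e∈
        ... | x , x∈ , refl with ∈E~-clone⁻ w w∈W j x (p∩q⊆q S~ _ x∈)
        ...   | w∈P , j≡ = proj₂ (∈S~⁻ (p∩q⊆p S~ _ x∈)) w w∈W w∈P j j≡
        from : part w j ⊆ img (S~ ∩ E~ (clone w w∈W j))
        from {e} e∈ = ∈-image⁺ πE _ (x∈p∩q⁺ (clone-copy-∈S~ w w∈W e w∈P j e∈ , clone-copy-∈E~ w w∈W e w∈P j))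
                                     (clone-copy-π w w∈W e w∈P j)
          where w∈P = ∈-Eof⁻ Pᴵ (p∩q⊆q S _ (part⊆ (splitting w w∈W) j e∈))

    fixed~-M : ∀ b → πA b ∉ W → C~ b (S~ ∩ E~ b) ≡ S~ ∩ E~ b
    fixed~-M b b∉W rewrite ∩E~-M b b∉W S~ | C~-M b b∉W =
      ⊆-antisym (λ x∈ → proj₁ (∈firstCopyCF⁻ (πA b) S~ x∈))
                (λ {x} x∈ → ∈firstCopyCF⁺ (πA b) S~ x∈
                   (λ y y∈ π≡ → ℕ.≤-reflexive (cong idxE (one-copy x y x∈ y∈ (sym π≡))))
                   (λ b∈P → subst (λ Z → πE x ∈ Cᴵ (πA b) (Z ∩ Eᴵ (πA b))) (sym img-S~)
                              (subst (πE x ∈_) (sym (proj₁ stable (πA b))) (x∈p∩q⁺ (proj₁ (∈S~⁻ x∈) , ∈-Eof⁺ Pᴵ b∈P)))))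

    fixed~-clone : ∀ w w∈W j → C~ (clone w w∈W j) (S~ ∩ E~ (clone w w∈W j)) ≡ S~ ∩ E~ (clone w w∈W j)
    fixed~-clone w w∈W j rewrite C~-clone w w∈W j =
      ⊆-antisym (λ x∈ → proj₁ (∈cloneCF⁻ w j _ x∈))
                (λ {x} x∈ → ∈cloneCF⁺ w j _ x∈ (subst (λ Z → πE x ∈ Cw w j Z) (sym (img-clone-S~ w w∈W j))
                   (subst (πE x ∈_) (sym (part-fixed (splitting w w∈W) j))
                      (subst (πE x ∈_) (img-clone-S~ w w∈W j) (∈-image⁺ πE _ x∈ refl)))))

    M-accepts⇒chosen : ∀ x m (m∉W : m ∉ W) → Accepts S~ x (M-clone m m∉W) → m ∈ Pᴵ (πE x)
                     → πE x ∈ Cᴵ m ((S ∩ Eᴵ m) ∪ ⁅ πE x ⁆)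
    M-accepts⇒chosen x m m∉W accepted m∈P =
      subst (λ Z → πE x ∈ Cᴵ m Z) offer≡
        (subst (λ v → Approved v (S~ ∪ ⁅ x ⁆) x) (M-clone-π m m∉W)
           (proj₂ (M-accepts⁻ (M-clone m m∉W) (M-clone-∉W m m∉W) S~ x accepted)) m∈P)
      where
        offer≡ : img (S~ ∪ ⁅ x ⁆) ∩ Eᴵ m ≡ (S ∩ Eᴵ m) ∪ ⁅ πE x ⁆
        offer≡ = trans (cong (_∩ Eᴵ m) (trans (image-∪⁅⁆ πE S~ x) (cong (_∪ ⁅ πE x ⁆) img-S~)))
                       (∪⁅⁆-∩ S (Eᴵ m) (∈-Eof⁺ Pᴵ m∈P))

    module _ (x : Fin nE~) (accepted : ∀ b → b ∈ P~ x → Accepts S~ x b) where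

      part-accepts : ∀ w w∈W (j : Fin (q w)) → w ∈ Pᴵ (πE x) → toℕ j ≡ idxE x
                   → πE x ∈ Cw w j (part w j ∪ ⁅ πE x ⁆)
      part-accepts w w∈W j w∈P j≡ =
        subst (λ Z → πE x ∈ Cw w j (Z ∪ ⁅ πE x ⁆)) (img-clone-S~ w w∈W j)
          (clone-accepts⁻ w w∈W j _ x (accepted (clone w w∈W j) (∈-Eof⁻ P~ (∈E~-clone⁺ w w∈W j x w∈P j≡))))

      chosen : πE x ∉ S → ∀ a → a ∈ Pᴵ (πE x) → πE x ∈ Cᴵ a ((S ∩ Eᴵ a) ∪ ⁅ πE x ⁆)
      chosen πx∉S a a∈P with a ∈? W
      ... | no a∉W = M-accepts⇒chosen x a a∉W (accepted _ (M∈P~ _ (M-clone-∉W a a∉W) x)) a∈P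
      ... | yes a∈W = subst (πE x ∈_) (sym (C≡bigStar a a∈W _ (∪⁅⁆-⊆ (p∩q⊆q S _) (∈-Eof⁺ Pᴵ a∈P))))
              (part-accepts⇒bigStar-accepts (Eᴵ a) (q a) (Cw a) (Cw-plott a a∈W) (part a) (S ∩ Eᴵ a)
                 (splitting a a∈W) (πE x) (∈-Eof⁺ Pᴵ a∈P) (λ πx∈ → πx∉S (p∩q⊆p S _ πx∈)) j
                 (part-accepts a a∈W j a∈P (toℕ-copy-number a a∈W x a∈P)))
        where j = copy-number a a∈W x a∈P

      -- An earlier part of w would reject πE x; a later part would hold an earlier copy of πE x in S~,
      -- which the M-clones prefer.
      selected : πE x ∈ S → Selected x
      selected πx∈S w w∈W w∈P j j≡ with covers (splitting w w∈W) (πE x) (x∈p∩q⁺ (πx∈S , ∈-Eof⁺ Pᴵ w∈P))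
      ... | j′ , in-j′ with ℕ.<-cmp (toℕ j) (toℕ j′)
      ...   | tri≈ _ j≡j′ _ = ∈part-transport refl (sym j≡j′) in-j′
      ...   | tri< j<j′ _ _ = ⊥-elim (rejects-later (splitting w w∈W) j j′ (πE x) in-j′ j<j′
                                       (part-accepts w w∈W j w∈P j≡))
      ...   | tri> _ _ j′<j = ⊥-elim (ℕ.<⇒≱ earlier (first y (p⊆p∪q _ y∈) π-y))
        where
          y = clone-copy w w∈W (πE x) w∈P j′
          π-y = clone-copy-π w w∈W (πE x) w∈P j′
          y∈ : y ∈ S~
          y∈ = clone-copy-∈S~ w w∈W (πE x) w∈P j′ in-j′
          earlier : idxE y < idxE x
          earlier = subst₂ _<_ (sym (clone-copy-idx w w∈W (πE x) w∈P j′)) j≡ j′<j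
          first : FirstCopy (S~ ∪ ⁅ x ⁆) x
          first = proj₁ (M-accepts⁻ b₀ b₀∉W S~ x (accepted b₀ (M∈P~ b₀ b₀∉W x)))
            where b₀∉W = M-clone-∉W m₀ m₀∉W

      closed~ : x ∈ S~
      closed~ with πE x ∈? S
      ... | yes πx∈S = ∈S~⁺ πx∈S (selected πx∈S)
      ... | no πx∉S  = ⊥-elim (πx∉S (proj₂ stable (πE x) (chosen πx∉S)))

    stable~ : Stable I~ S~
    stable~ = fixed~ , closed~
      where
        fixed~ : ∀ b → C~ b (S~ ∩ E~ b) ≡ S~ ∩ E~ b
        fixed~ b with agent-cases b
        ... | inj₁ b∉W = fixed~-M b b∉W
        ... | inj₂ (b∈W , j , clone≡b) =
              subst (λ b → C~ b (S~ ∩ E~ b) ≡ S~ ∩ E~ b) clone≡b (fixed~-clone (πA b) b∈W j)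

  reduction-with-M : Reduction I W q Cw
  reduction-with-M = reduction
    (λ S~ stable~ → Project.stable S~ stable~)
    (λ S~ T~ stableS stableT img≡ →
       ⊆-antisym (projection-⊆ S~ T~ stableS stableT img≡) (projection-⊆ T~ S~ stableT stableS (sym img≡)))
    (λ S stable → Lift.S~ S stable , Lift.stable~ S stable , Lift.img-S~ S stable)

-- The case M = ∅

-- Now every contract has at most one participant, in I and in the split
-- problem, so each has exactly one stable set.  One spare copy of every
-- contract of the stable set of I makes it the image of the other one.
module SplitWithoutM (I : Problem) (W : Subset (nA I))
    (unconnected : ∀ e → ∣ P I e ∩ W ∣ ≤ 1)
    (q : Fin (nA I) → ℕ) (Cw : (w : Fin (nA I)) → Fin (q w) → CF (nE I))
    (Cw-plott : ∀ w → w ∈ W → ∀ j → Plott (E[_] I w) (Cw w j))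
    (C≡bigStar : ∀ w → w ∈ W → ∀ A → A ⊆ E[_] I w → C I w A ≡ bigStar (q w) (Cw w) A)
    (all-W : ∀ a → a ∈ W) where

  one-participant : ∀ e a b → a ∈ P I e → b ∈ P I e → a ≡ b
  one-participant e a b a∈P b∈P =
    ∣p∣≤1⇒x≡y (P I e ∩ W) (unconnected e) (x∈p∩q⁺ (a∈P , all-W a)) (x∈p∩q⁺ (b∈P , all-W b))

  module Stableᴵ = AtMostOneParticipant I one-participant

  opaque
    spare : Fin (nE I) → ℕ
    spare e with e ∈? Stableᴵ.canonical
    ... | yes _ = 1
    ... | no _  = 0

    spare≡1 : ∀ e → e ∈ Stableᴵ.canonical → spare e ≡ 1
    spare≡1 e e∈ with e ∈? Stableᴵ.canonical
    ... | yes _ = refl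
    ... | no e∉ = ⊥-elim (e∉ e∈)

    spare≡0 : ∀ e → e ∉ Stableᴵ.canonical → spare e ≡ 0
    spare≡0 e e∉ with e ∈? Stableᴵ.canonical
    ... | yes e∈ = ⊥-elim (e∉ e∈)
    ... | no _   = refl

  open Split I W unconnected q Cw Cw-plott spare

  copies<slots : ∀ e → e ∈ Stableᴵ.canonical → copies e < slots e
  copies<slots e e∈ = subst (λ s → copies e < copies e + s) (sym (spare≡1 e e∈))
                        (subst (copies e <_) (ℕ.+-comm 1 (copies e)) ℕ.≤-refl)

  slots≡copies : ∀ e → e ∉ Stableᴵ.canonical → slots e ≡ copies e
  slots≡copies e e∉ = trans (cong (copies e +_) (spare≡0 e e∉)) (ℕ.+-identityʳ (copies e))

  one-participant~ : ∀ x b b′ → b ∈ P~ x → b′ ∈ P~ x → b ≡ b′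
  one-participant~ x b b′ b∈ b′∈ with W-participates b x (all-W (πA b)) (∈P~⁻ b∈)
                                    | W-participates b′ x (all-W (πA b′)) (∈P~⁻ b′∈)
  ... | b∈P , idx≡ | b′∈P , idx≡′ = agent-≡ b b′
        (W-participant-unique (πE x) (πA b) (πA b′) b∈P (all-W _) b′∈P (all-W _)) (trans idx≡ (sym idx≡′))

  module Stable~ = AtMostOneParticipant I~ one-participant~

  spare-copy-∈ : ∀ e (e∈ : e ∈ Stableᴵ.canonical) → slot e (copies e) (copies<slots e e∈) ∈ Stable~.canonical
  spare-copy-∈ e e∈ = Stable~.∈-canonical⁺ λ b b∈P → ⊥-elim (ℕ.<-irrefl refl
    (subst₂ (λ i e → i < copies e) (slot-idx e (copies e) _) (slot-π e (copies e) _) (proj₁ (∈P~⁻ b∈P))))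

  img-E~-clone : ∀ w w∈W j → img (E~ (clone w w∈W j)) ≡ Eᴵ w
  img-E~-clone w w∈W j = ⊆-antisym (img-clone⊆E w w∈W j _ (λ x∈ → x∈)) λ {e} e∈ →
    let (x , x∈ , π≡) = πE-surj w w∈W j e e∈ in ∈-image⁺ πE _ x∈ π≡

  -- A chosen non-spare copy x has a single participant, a clone w(j) that takes it against
  -- all its contracts; then C_{w(j)}, and so C_w, takes πE x against E(w).
  genuine-chosen : ∀ x → x ∈ Stable~.canonical → πE x ∉ Stableᴵ.canonical → Stableᴵ.Chosen (πE x)
  genuine-chosen x x∈ πx∉ a a∈P = subst (πE x ∈_) (sym (C≡bigStar a (all-W a) (Eᴵ a) (λ e∈ → e∈)))
    (F⊆bigStar (Eᴵ a) (q a) (Cw a) (Cw-plott a (all-W a)) (Eᴵ a) (λ e∈ → e∈) j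
       (subst (λ Z → πE x ∈ Cw a j Z) (img-E~-clone a (all-W a) j)
          (clone-accepts-all (Stable~.∈-canonical⁻ x∈ (clone a (all-W a) j)
             (∈-Eof⁻ P~ (∈E~-clone⁺ a (all-W a) j x a∈P (Fin.toℕ-fromℕ< idx<q)))))))
    where
      idx<q : idxE x < q a
      idx<q = subst (idxE x <_) (trans (slots≡copies (πE x) πx∉) (copies≡q (πE x) a a∈P (all-W a)))
                (idxE<slots x)
      j = fromℕ< idx<q
      clone-accepts-all : x ∈ C~ (clone a (all-W a) j) (E~ (clone a (all-W a) j))
                        → πE x ∈ Cw a j (img (E~ (clone a (all-W a) j)))
      clone-accepts-all x∈C rewrite C~-clone a (all-W a) j = proj₂ (∈cloneCF⁻ a j _ x∈C)

  img-canonical : img Stable~.canonical ≡ Stableᴵ.canonical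
  img-canonical = ⊆-antisym to from
    where
      to : img Stable~.canonical ⊆ Stableᴵ.canonical
      to e∈ with ∈-image⁻ πE _ e∈
      ... | x , x∈ , refl with πE x ∈? Stableᴵ.canonical
      ...   | yes πx∈ = πx∈
      ...   | no πx∉  = Stableᴵ.∈-canonical⁺ (genuine-chosen x x∈ πx∉)
      from : Stableᴵ.canonical ⊆ img Stable~.canonical
      from {e} e∈ = ∈-image⁺ πE _ (spare-copy-∈ e e∈) (slot-π e (copies e) _)

  reduction-without-M : Reduction I W q Cw
  reduction-without-M = reduction
    (λ S~ stable~ → subst (Stable I)
       (sym (trans (cong img (Stable~.stable⇒≡canonical S~ stable~)) img-canonical)) Stableᴵ.canonical-stable)
    (λ S~ T~ stableS stableT _ →
       trans (Stable~.stable⇒≡canonical S~ stableS) (sym (Stable~.stable⇒≡canonical T~ stableT)))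
    (λ S stable → Stable~.canonical , Stable~.canonical-stable
                , trans img-canonical (sym (Stableᴵ.stable⇒≡canonical S stable)))

theorem3 : (I : Problem) (W : Subset (nA I))
    → (∀ e → ∣ P I e ∩ W ∣ ≤ 1)
    → (q : Fin (nA I) → ℕ) (Cw : (w : Fin (nA I)) → Fin (q w) → CF (nE I))
    → (∀ w → w ∈ W → ∀ j → Plott (E[_] I w) (Cw w j))
    → (∀ w → w ∈ W → ∀ A → A ⊆ E[_] I w → C I w A ≡ bigStar (q w) (Cw w) A)
    → Reduction I W q Cw
theorem3 I W unconnected q Cw Cw-plott C≡bigStar with Fin.any? (λ a → ¬? (a ∈? W))
... | yes (m₀ , m₀∉W) = SplitWithM.reduction-with-M I W unconnected q Cw Cw-plott C≡bigStar m₀ m₀∉W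
... | no no-M = SplitWithoutM.reduction-without-M I W unconnected q Cw Cw-plott C≡bigStar
                  λ a → decidable-stable (a ∈? W) λ a∉W → no-M (a , a∉W)
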